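{- Let $\tilde\Lambda$ be the fringed quiver of a gentle algebra. The turbulence polyhedron $\mathcal F_1(\tilde\Lambda)$ has dimension $|E|-|V_{\mathrm{int}}|-1=|V_{\mathrm{int}}|+s-1$, where $s$ is the number of straight routes of $\tilde\Lambda$.
   Context: Let $\Lambda=kQ/I$ be a gentle algebra over an algebraically closed field ($Q$ finite, $I$ admissible generated by length-two paths, at most two arrows in and out at each vertex, and for each arrow at most one continuation without relation and at most one with relation on each side). Its fringed quiver $\tilde\Lambda$ is obtained by adding at each vertex $v$ of $Q$ new arrows to/from new fringe vertices so that $v$ has in- and out-degree exactly $2$, with relations keeping the gentle conditions. $V_{\mathrm{int}}$ is the set of vertices of $Q$ (internal vertices), $E$ the set of all arrows of $\tilde\Lambda$; fringe arrows are those incident to fringe vertices. Each internal vertex $v$ has relations $\alpha_1\alpha_2,\beta_1\beta_2$ with $h(\alpha_1)=h(\beta_1)=t(\alpha_2)=t(\beta_2)=v$. Strings are words in signed arrows ($h(\alpha^{ -1})=t(\alpha)$) with matching endpoints, avoiding $\beta\gamma$ and $\gamma^{ -1}\beta^{ -1}$ for relations $\beta\gamma$ and avoiding $\alpha\alpha^{ -1},\alpha^{ -1}\alpha$. A route is a maximal string; it is straight if all its arrows have the same sign (an oriented path). A flow is $F:E\to\mathbb R_{\ge0}$ with $F(\alpha_1)+F(\alpha_2)=F(\beta_1)+F(\beta_2)$ at each internal vertex; $\mathcal F_1(\tilde\Lambda)\subseteq\mathbb R^E$ is the set of flows with $\frac12\sum_{\alpha\text{ fringe}}F(\alpha)=1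$.
   Formalization: Flows take rational values, so the turbulence polyhedron $\mathcal F_1(\tilde\Lambda)$ and its dimension are taken in ℚ^E rather than $\mathbb R^E$. -}

module Defs where

open import Data.Nat using (ℕ; zero; suc; _≤_)
open import Data.Fin using (Fin; zero; suc)
open import Data.Bool using (Bool; true; false; if_then_else_)
open import Data.Sum using (_⊎_; inj₁; inj₂)
open import Data.Product using (Σ; ∃; _×_; _,_)
open import Data.List using (List; []; _∷_; length; map; reverse; _∷ʳ_)
open import Data.List.Relation.Unary.Linked using (Linked)
open import Data.List.Relation.Unary.All using (All)
open import Data.List.Relation.Unary.AllPairs using (AllPairs)
open import Data.List.Membership.Propositional using (_∈_)
open import Data.Rational using (ℚ; 0ℚ; _+_; _*_; _≤_; ½; 1ℚ)
open import Data.Integer as ℤ using (ℤ; +_)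
open import Relation.Binary.PropositionalEquality using (_≡_; _≢_)
open import Relation.Nullary using (¬_)
open import Data.Empty using (⊥)
open import Data.Unit using (⊤)

-- Bound quivers with relations of length two.
-- Rel α β ≡ true means that the length-two path "α then β" (written αβ,
-- with h(α) = t(β)) is a relation (an element of I).

record Quiver : Set₁ where
  field
    Vtx Arr : Set
    tl hd   : Arr → Vtx
    Rel     : Arr → Arr → Bool

module _ (Q : Quiver) where
  open Quiver Q

  RelWellFormed : Set
  RelWellFormed = ∀ α β → Rel α β ≡ true → hd α ≡ tl β

  record GentleLocal : Set where
    field
      in≤2  : ∀ v a b c → hd a ≡ v → hd b ≡ v → hd c ≡ v → a ≡ b ⊎ a ≡ c ⊎ b ≡ c
      out≤2 : ∀ v a b c → tl a ≡ v → tl b ≡ v → tl c ≡ v → a ≡ b ⊎ a ≡ c ⊎ b ≡ c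
      pre-rel    : ∀ β α α' → hd α ≡ tl β → hd α' ≡ tl β →
                   Rel α β ≡ true → Rel α' β ≡ true → α ≡ α'
      pre-nonrel : ∀ β α α' → hd α ≡ tl β → hd α' ≡ tl β →
                   Rel α β ≡ false → Rel α' β ≡ false → α ≡ α'
      post-rel    : ∀ β γ γ' → tl γ ≡ hd β → tl γ' ≡ hd β →
                    Rel β γ ≡ true → Rel β γ' ≡ true → γ ≡ γ'
      post-nonrel : ∀ β γ γ' → tl γ ≡ hd β → tl γ' ≡ hd β →
                    Rel β γ ≡ false → Rel β γ' ≡ false → γ ≡ γ'

  NonRelStep : Arr → Arr → Set
  NonRelStep α β = (hd α ≡ tl β) × (Rel α β ≡ false)

  -- I admissible (kQ/I finite-dimensional): all long enough paths
  -- contain a relation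
  Admissible : Set
  Admissible = ∃ λ N → ∀ (p : List Arr) → length p ≡ N → ¬ Linked NonRelStep p

record GentleAlgebra : Set₁ where
  field
    n m : ℕ
    tl hd : Fin m → Fin n
    Rel : Fin m → Fin m → Bool

  quiver : Quiver
  quiver = record { Vtx = Fin n ; Arr = Fin m ; tl = tl ; hd = hd ; Rel = Rel }

  field
    wf         : RelWellFormed quiver
    gentle     : GentleLocal quiver
    admissible : Admissible quiver

-- The fringe arrow j
-- joins the internal vertex at j to the (new) fringe vertex j; it points
-- outward (internal → fringe) iff out j ≡ true.

module _ (Λ : GentleAlgebra) where
  open GentleAlgebra Λ

  fTl : (b : ℕ) → (Fin b → Fin n) → (Fin b → Bool) → Fin m ⊎ Fin b → Fin n ⊎ Fin b
  fTl b at out (inj₁ a) = inj₁ (tl a)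
  fTl b at out (inj₂ j) = if out j then inj₁ (at j) else inj₂ j

  fHd : (b : ℕ) → (Fin b → Fin n) → (Fin b → Bool) → Fin m ⊎ Fin b → Fin n ⊎ Fin b
  fHd b at out (inj₁ a) = inj₁ (hd a)
  fHd b at out (inj₂ j) = if out j then inj₂ j else inj₁ (at j)

  record Fringing : Set₁ where
    field
      b   : ℕ
      at  : Fin b → Fin n
      out : Fin b → Bool
      Rel~ : Fin m ⊎ Fin b → Fin m ⊎ Fin b → Bool

    quiver~ : Quiver
    quiver~ = record { Vtx = Fin n ⊎ Fin b ; Arr = Fin m ⊎ Fin b
                     ; tl = fTl b at out ; hd = fHd b at out ; Rel = Rel~ }

    field
      extends : ∀ a a' → Rel~ (inj₁ a) (inj₁ a') ≡ Rel a a'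
      wf~     : RelWellFormed quiver~
      gentle~ : GentleLocal quiver~
      in=2  : ∀ v → Σ (Fin m ⊎ Fin b) λ x → Σ (Fin m ⊎ Fin b) λ y →
                x ≢ y × fHd b at out x ≡ inj₁ v × fHd b at out y ≡ inj₁ v ×
                (∀ z → fHd b at out z ≡ inj₁ v → z ≡ x ⊎ z ≡ y)
      out=2 : ∀ v → Σ (Fin m ⊎ Fin b) λ x → Σ (Fin m ⊎ Fin b) λ y →
                x ≢ y × fTl b at out x ≡ inj₁ v × fTl b at out y ≡ inj₁ v ×
                (∀ z → fTl b at out z ≡ inj₁ v → z ≡ x ⊎ z ≡ y)

data Letter (A : Set) : Set where
  dir : A → Letter A
  inv : A → Letter A

module _ (Q : Quiver) where
  open Quiver Q

  lHd lTl : Letter Arr → Vtx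
  lHd (dir a) = hd a
  lHd (inv a) = tl a
  lTl (dir a) = tl a
  lTl (inv a) = hd a

  Forbidden : Letter Arr → Letter Arr → Set
  Forbidden (dir β) (dir γ) = Rel β γ ≡ true
  Forbidden (inv γ) (inv β) = Rel β γ ≡ true
  Forbidden (dir α) (inv α') = α ≡ α'
  Forbidden (inv α) (dir α') = α ≡ α'

  Step : Letter Arr → Letter Arr → Set
  Step l l' = (lHd l ≡ lTl l') × ¬ Forbidden l l'

  IsString : List (Letter Arr) → Set
  IsString w = (w ≢ []) × Linked Step w

  IsRoute : List (Letter Arr) → Set
  IsRoute w = IsString w × (¬ ∃ λ l → IsString (w ∷ʳ l)) × (¬ ∃ λ l → IsString (l ∷ w))

  IsDir IsInv : Letter Arr → Set
  IsDir (dir _) = ⊤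
  IsDir (inv _) = ⊥
  IsInv (dir _) = ⊥
  IsInv (inv _) = ⊤

  IsStraightRoute : List (Letter Arr) → Set
  IsStraightRoute w = IsRoute w × (All IsDir w ⊎ All IsInv w)

  flipL : Letter Arr → Letter Arr
  flipL (dir a) = inv a
  flipL (inv a) = dir a

  inverse : List (Letter Arr) → List (Letter Arr)
  inverse w = reverse (map flipL w)

  CountsStraightRoutes : List (List (Letter Arr)) → Set
  CountsStraightRoutes L =
    All IsStraightRoute L ×
    (∀ w → IsStraightRoute w → w ∈ L ⊎ inverse w ∈ L) ×
    AllPairs (λ u v → u ≢ v × u ≢ inverse v) L

sumFin : (k : ℕ) → (Fin k → ℚ) → ℚ
sumFin zero    f = 0ℚ
sumFin (suc k) f = f zero + sumFin k (λ i → f (suc i))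

AffinelyIndependent : {A : Set} (k : ℕ) → (Fin k → (A → ℚ)) → Set
AffinelyIndependent k p =
  ∀ (c : Fin k → ℚ) → sumFin k c ≡ 0ℚ →
    (∀ e → sumFin k (λ i → c i * p i e) ≡ 0ℚ) → ∀ i → c i ≡ 0ℚ

-- P has (affine) dimension d : ℤ  (d = -1 iff P = ∅): the maximal number
-- of affinely independent points of P is d + 1.
HasDimension : {A : Set} → ((A → ℚ) → Set) → ℤ → Set
HasDimension P d = Σ ℕ λ N → (d ℤ.+ ℤ.1ℤ ≡ + N) ×
  (Σ (Fin N → _) λ p → (∀ i → P (p i)) × AffinelyIndependent N p) ×
  (∀ k (p : Fin k → _) → (∀ i → P (p i)) → AffinelyIndependent k p → k Data.Nat.≤ N)

module _ {Λ : GentleAlgebra} (Λ~ : Fringing Λ) where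
  open GentleAlgebra Λ
  open Fringing Λ~

  E : Set
  E = Fin m ⊎ Fin b

  IsFlow : (E → ℚ) → Set
  IsFlow F = (∀ e → 0ℚ Data.Rational.≤ F e) ×
    (∀ α₁ α₂ β₁ β₂ → Rel~ α₁ α₂ ≡ true → Rel~ β₁ β₂ ≡ true →
       fHd Λ b at out α₁ ≡ fHd Λ b at out β₁ → F α₁ + F α₂ ≡ F β₁ + F β₂)

  F₁ : (E → ℚ) → Set
  F₁ F = IsFlow F × (½ * sumFin b (λ j → F (inj₂ j)) ≡ 1ℚ)

{-# OPTIONS --safe #-}
module Submission where

-- At an internal vertex with relations α₁α₂ and β₁β₂ the conservation law reads
-- F(α₂) − F(β₁) = F(β₂) − F(α₁): crossing the vertex along either relation-free composition
-- raises F by the same increment Δᵥ. By admissibility, following relation-free compositions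
-- backwards from any arrow reaches the fringe, so a conserving F is determined by its n
-- increments and its values on the s arrows leaving the fringe, and all nonnegative such data
-- are realised by flows. Hence the flows form a cone of dimension n + s and its slice F₁ has
-- dimension n + s − 1. Counting arrow ends at the internal vertices, which have in- and
-- out-degree 2, gives |E| = 2n + s and shows that s is also the number of arrows into the
-- fringe; the straight routes are exactly the backward relation-free paths from those arrows.

open import Algebra.Bundles using (Semiring)
open import Defs

module SemiringSum {c ℓ} (R : Semiring c ℓ) where
  open import Data.Nat as ℕ using (ℕ; zero; suc)
  open import Data.Fin as Fin using (Fin; zero; suc; punchIn; _↑ˡ_; _↑ʳ_)
  import Data.Fin.Properties as FinP
  open import Data.Bool using (if_then_else_)
  open import Data.Sum using (_⊎_; inj₁; inj₂)
  open import Data.Vec.Functional using (removeAt)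
  open import Function using (_∘_)
  import Relation.Binary.PropositionalEquality as ≡
  open import Relation.Nullary using (Dec; does; yes; no; contradiction)

  open Semiring R
  open import Algebra.Properties.Semiring.Sum R public
  open import Relation.Binary.Reasoning.Setoid setoid

  𝟙 : ∀ {p} {P : Set p} → Dec P → Carrier
  𝟙 d = if does d then 1# else 0#

  𝟙-sym : ∀ {n} (x y : Fin n) → 𝟙 (x Fin.≟ y) ≈ 𝟙 (y Fin.≟ x)
  𝟙-sym x y with x Fin.≟ y | y Fin.≟ x
  ... | yes _   | yes _   = refl
  ... | no _    | no _    = refl
  ... | yes x≡y | no y≢x  = contradiction (≡.sym x≡y) y≢x
  ... | no x≢y  | yes y≡x = contradiction (≡.sym y≡x) x≢y

  𝟙-refl : ∀ {n} (x : Fin n) → 𝟙 (x Fin.≟ x) ≈ 1#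
  𝟙-refl x with x Fin.≟ x
  ... | yes _   = refl
  ... | no x≢x = contradiction ≡.refl x≢x

  𝟙-injective : ∀ {m n} {f : Fin m → Fin n} → (∀ {x y} → f x ≡.≡ f y → x ≡.≡ y) →
                ∀ x y → 𝟙 (f x Fin.≟ f y) ≈ 𝟙 (x Fin.≟ y)
  𝟙-injective {f = f} injective x y with f x Fin.≟ f y | x Fin.≟ y
  ... | yes _     | yes _   = refl
  ... | no _      | no _    = refl
  ... | yes fx≡fy | no x≢y  = contradiction (injective fx≡fy) x≢y
  ... | no fx≢fy  | yes x≡y = contradiction (≡.cong f x≡y) fx≢fy

  ∑-select : ∀ {n} (f : Fin n → Carrier) (x : Fin n) →
             ∑[ i < n ] (f i * 𝟙 (i Fin.≟ x)) ≈ f x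
  ∑-select {suc n} f x = begin
    ∑[ i < suc n ] (f i * 𝟙 (i Fin.≟ x))
      ≈⟨ sum-remove {i = x} (λ i → f i * 𝟙 (i Fin.≟ x)) ⟩
    f x * 𝟙 (x Fin.≟ x) + sum (removeAt (λ i → f i * 𝟙 (i Fin.≟ x)) x)
      ≈⟨ +-cong (*-congˡ (𝟙-refl x)) (sum-cong-≋ (λ j → *-congˡ (𝟙-punchIn j))) ⟩
    f x * 1# + ∑[ j < n ] (f (punchIn x j) * 0#)
      ≈⟨ +-cong (*-identityʳ (f x)) (sum-cong-≋ (λ j → zeroʳ (f (punchIn x j)))) ⟩
    f x + ∑[ j < n ] 0#
      ≈⟨ +-congˡ (sum-replicate-zero n) ⟩
    f x + 0#
      ≈⟨ +-identityʳ (f x) ⟩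
    f x ∎
    where
    𝟙-punchIn : ∀ j → 𝟙 (punchIn x j Fin.≟ x) ≈ 0#
    𝟙-punchIn j with punchIn x j Fin.≟ x
    ... | yes eq = contradiction eq (FinP.punchInᵢ≢i x j)
    ... | no _   = refl

  ∑-𝟙≟ : ∀ {n} (x : Fin n) → ∑[ i < n ] 𝟙 (i Fin.≟ x) ≈ 1#
  ∑-𝟙≟ x = trans (sum-cong-≋ (λ i → sym (*-identityˡ (𝟙 (i Fin.≟ x))))) (∑-select (λ _ → 1#) x)

  sum-↑ : ∀ m n (f : Fin (m ℕ.+ n) → Carrier) →
          sum f ≈ ∑[ i < m ] f (i ↑ˡ n) + ∑[ j < n ] f (m ↑ʳ j)
  sum-↑ zero    n f = sym (+-identityˡ (sum f))
  sum-↑ (suc m) n f = trans (+-congˡ (sum-↑ m n (f ∘ suc))) (sym (+-assoc _ _ _))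

  ∑-splitAt : ∀ m n (c : Fin (m ℕ.+ n) → Carrier) (g : Fin m ⊎ Fin n → Carrier) →
    ∑[ i < m ℕ.+ n ] (c i * g (Fin.splitAt m i))
      ≈ ∑[ i < m ] (c (i ↑ˡ n) * g (inj₁ i)) + ∑[ j < n ] (c (m ↑ʳ j) * g (inj₂ j))
  ∑-splitAt m n c g = trans (sum-↑ m n (λ i → c i * g (Fin.splitAt m i)))
    (+-cong (sum-cong-≋ (λ i → reflexive (≡.cong (λ x → c (i ↑ˡ n) * g x) (FinP.splitAt-↑ˡ m i n))))
            (sum-cong-≋ (λ j → reflexive (≡.cong (λ x → c (m ↑ʳ j) * g x) (FinP.splitAt-↑ʳ m n j)))))

module RationalArithmetic where
  open import Algebra.Bundles using (CommutativeRing)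
  open import Level using (0ℓ)
  open import Data.Nat using (zero; suc)
  open import Data.Fin using (Fin; zero; suc; punchIn)
  open import Data.Maybe using (Maybe; just; nothing)
  open import Data.Rational as ℚ using (ℚ; 0ℚ; 1ℚ; _+_; _*_; _-_; _≟_; _≤_; _<_)
  import Data.Rational.Properties as ℚP
  open import Data.Vec.Functional using (removeAt)
  open import Function using (_∘_)
  open import Relation.Binary.PropositionalEquality
  open import Relation.Nullary using (Dec; does; yes; no)
  open import Data.Bool using (true; false)
  open import Tactic.RingSolver using (solve-∀)
  open import Tactic.RingSolver.Core.AlmostCommutativeRing using (AlmostCommutativeRing; fromCommutativeRing)

  ℚ-ring : AlmostCommutativeRing 0ℓ 0ℓ
  ℚ-ring = fromCommutativeRing ℚP.+-*-commutativeRing is-zero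
    where
    is-zero : (x : ℚ) → Maybe (0ℚ ≡ x)
    is-zero x with 0ℚ ≟ x
    ... | yes 0≡x = just 0≡x
    ... | no _    = nothing

  open SemiringSum (CommutativeRing.semiring ℚP.+-*-commutativeRing) public

  sumFin≡sum : ∀ k (f : Fin k → ℚ) → sumFin k f ≡ sum f
  sumFin≡sum zero    f = refl
  sumFin≡sum (suc k) f = cong (f zero +_) (sumFin≡sum k (f ∘ suc))

  ∑-distrib-difference : ∀ {k} (f g : Fin k → ℚ) → ∑[ i < k ] (f i - g i) ≡ sum f - sum g
  ∑-distrib-difference {zero}  f g = refl
  ∑-distrib-difference {suc k} f g = trans (cong (f zero - g zero +_) (∑-distrib-difference (f ∘ suc) (g ∘ suc)))
    (rearrange (f zero) (g zero) (sum (f ∘ suc)) (sum (g ∘ suc)))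
    where
    rearrange : ∀ a b c d → (a - b) + (c - d) ≡ (a + c) - (b + d)
    rearrange = solve-∀ ℚ-ring

  *-cancelʳ-≢0 : ∀ {x a} → a ≢ 0ℚ → x * a ≡ 0ℚ → x ≡ 0ℚ
  *-cancelʳ-≢0 {x} {a} a≢0 xa≡0 = begin
    x                ≡⟨ sym (ℚP.*-identityʳ x) ⟩
    x * 1ℚ           ≡⟨ cong (x *_) (sym (ℚP.*-inverseʳ a)) ⟩
    x * (a * ℚ.1/ a) ≡⟨ sym (ℚP.*-assoc x a _) ⟩
    (x * a) * ℚ.1/ a ≡⟨ cong (_* ℚ.1/ a) xa≡0 ⟩
    0ℚ * ℚ.1/ a      ≡⟨ ℚP.*-zeroˡ (ℚ.1/ a) ⟩
    0ℚ               ∎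
    where
    open ≡-Reasoning
    instance
      a-nonZero : ℚ.NonZero a
      a-nonZero = ℚ.≢-nonZero a≢0

  *-nonneg : ∀ {x y} → 0ℚ ≤ x → 0ℚ ≤ y → 0ℚ ≤ x * y
  *-nonneg {x} {y} x≥0 y≥0 = ℚP.nonNegative⁻¹ (x * y)
    {{ℚP.nonNeg*nonNeg⇒nonNeg x {{ℚ.nonNegative x≥0}} y {{ℚ.nonNegative y≥0}}}}

  ∑-nonneg : ∀ {k} (f : Fin k → ℚ) → (∀ i → 0ℚ ≤ f i) → 0ℚ ≤ sum f
  ∑-nonneg {zero}  f f≥0 = ℚP.≤-refl
  ∑-nonneg {suc k} f f≥0 = ℚP.+-mono-≤ (f≥0 zero) (∑-nonneg (f ∘ suc) (f≥0 ∘ suc))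

  ∑-pos : ∀ {k} (f : Fin k → ℚ) → (∀ i → 0ℚ ≤ f i) → ∀ i → 0ℚ < f i → 0ℚ < sum f
  ∑-pos {suc k} f f≥0 i fi>0 = subst (0ℚ <_) (sym (sum-remove {i = i} f))
    (ℚP.+-mono-<-≤ fi>0 (∑-nonneg (removeAt f i) (f≥0 ∘ punchIn i)))

  𝟙-nonneg : ∀ {p} {P : Set p} (d : Dec P) → 0ℚ ≤ 𝟙 d
  𝟙-nonneg d with does d
  ... | true  = ℚP.<⇒≤ (ℚP.positive⁻¹ 1ℚ)
  ... | false = ℚP.≤-refl

module LinearAlgebra where
  open import Data.Nat as ℕ using (ℕ; zero; suc; z≤n; s≤s)
  import Data.Nat.Properties as ℕP
  open import Data.Fin using (Fin; zero; suc; punchIn)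
  import Data.Fin.Properties as FinP
  open import Data.Product using (_,_)
  open import Data.Rational using (ℚ; 0ℚ; 1ℚ; _+_; _*_; _-_; -_; _≟_)
  import Data.Rational.Properties as ℚP
  open import Data.Vec.Functional using (insertAt; removeAt)
  open import Data.Vec.Functional.Properties using (insertAt-lookup; insertAt-punchIn)
  open import Relation.Binary.PropositionalEquality
  open import Relation.Nullary using (yes; no)
  open import Tactic.RingSolver using (solve-∀)
  open RationalArithmetic

  LinearlyIndependent : (k D : ℕ) → (Fin k → Fin D → ℚ) → Set
  LinearlyIndependent k D v =
    ∀ (c : Fin k → ℚ) → (∀ d → ∑[ i < k ] (c i * v i d) ≡ 0ℚ) → ∀ i → c i ≡ 0ℚ

  module Elimination {k D} (v : Fin (suc k) → Fin (suc D) → ℚ) (pivot : Fin (suc k)) where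

    a : ℚ
    a = v pivot zero

    reduced : Fin k → Fin (suc D) → ℚ
    reduced i d = a * v (punchIn pivot i) d - v (punchIn pivot i) zero * v pivot d

    reduced-zero : ∀ i → reduced i zero ≡ 0ℚ
    reduced-zero i = cancel a (v (punchIn pivot i) zero)
      where
      cancel : ∀ x y → x * y - y * x ≡ 0ℚ
      cancel = solve-∀ ℚ-ring

    lift : (Fin k → ℚ) → Fin (suc k) → ℚ
    lift c = insertAt (λ i → c i * a) pivot (- ∑[ i < k ] (c i * v (punchIn pivot i) zero))

    lift-combination : ∀ c d →
      ∑[ i < suc k ] (lift c i * v i d) ≡ ∑[ i < k ] (c i * reduced i d)
    lift-combination c d = begin
      ∑[ i < suc k ] (lift c i * v i d)
        ≡⟨ sum-remove {i = pivot} (λ i → lift c i * v i d) ⟩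
      lift c pivot * v pivot d + ∑[ i < k ] (lift c (punchIn pivot i) * v′ i d)
        ≡⟨ cong₂ (λ x y → x * v pivot d + y) (insertAt-lookup _ pivot _)
                 (sum-cong-≗ (λ i → cong (_* v′ i d) (insertAt-punchIn _ pivot _ i))) ⟩
      (- S) * v pivot d + ∑[ i < k ] ((c i * a) * v′ i d)
        ≡⟨ swap-neg S (v pivot d) _ ⟩
      T - S * v pivot d
        ≡⟨ cong (λ x → T - x) (*-distribʳ-sum (v pivot d) (λ i → c i * v′ i zero)) ⟩
      T - ∑[ i < k ] ((c i * v′ i zero) * v pivot d)
        ≡⟨ sym (∑-distrib-difference (λ i → (c i * a) * v′ i d) (λ i → (c i * v′ i zero) * v pivot d)) ⟩
      ∑[ i < k ] ((c i * a) * v′ i d - (c i * v′ i zero) * v pivot d)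
        ≡⟨ sum-cong-≗ (λ i → factor (c i) a (v′ i d) (v′ i zero) (v pivot d)) ⟩
      ∑[ i < k ] (c i * reduced i d) ∎
      where
      open ≡-Reasoning
      v′ : Fin k → Fin (suc D) → ℚ
      v′ = removeAt v pivot
      S T : ℚ
      S = ∑[ i < k ] (c i * v′ i zero)
      T = ∑[ i < k ] ((c i * a) * v′ i d)
      swap-neg : ∀ x y z → (- x) * y + z ≡ z - x * y
      swap-neg = solve-∀ ℚ-ring
      factor : ∀ x a y z w → (x * a) * y - (x * z) * w ≡ x * (a * y - z * w)
      factor = solve-∀ ℚ-ring

    reduced-independent : a ≢ 0ℚ → LinearlyIndependent (suc k) (suc D) v →
                          LinearlyIndependent k D (λ i d → reduced i (suc d))
    reduced-independent a≢0 independent c combination≡0 i = *-cancelʳ-≢0 a≢0 (begin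
      c i * a                  ≡⟨ sym (insertAt-punchIn _ pivot _ i) ⟩
      lift c (punchIn pivot i) ≡⟨ independent (lift c) lifted≡0 (punchIn pivot i) ⟩
      0ℚ                       ∎)
      where
      open ≡-Reasoning
      lifted≡0 : ∀ d → ∑[ i < suc k ] (lift c i * v i d) ≡ 0ℚ
      lifted≡0 d = trans (lift-combination c d) (reduced≡0 d)
        where
        reduced≡0 : ∀ d → ∑[ i < k ] (c i * reduced i d) ≡ 0ℚ
        reduced≡0 zero    = trans (sum-cong-≗ (λ i → trans (cong (c i *_) (reduced-zero i)) (ℚP.*-zeroʳ (c i))))
                                  (sum-replicate-zero k)
        reduced≡0 (suc d) = combination≡0 d

  linearlyIndependent⇒≤ : ∀ {k D} (v : Fin k → Fin D → ℚ) → LinearlyIndependent k D v → k ℕ.≤ D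
  linearlyIndependent⇒≤ {zero}          v independent = z≤n
  linearlyIndependent⇒≤ {suc k} {zero}  v independent with independent (λ _ → 1ℚ) (λ ()) zero
  ... | ()
  linearlyIndependent⇒≤ {suc k} {suc D} v independent with FinP.all? (λ i → v i zero ≟ 0ℚ)
  ... | yes column≡0 = ℕP.m≤n⇒m≤1+n (linearlyIndependent⇒≤ (λ i d → v i (suc d)) dropped)
    where
    dropped : LinearlyIndependent (suc k) D (λ i d → v i (suc d))
    dropped c combination≡0 = independent c λ where
      zero    → trans (sum-cong-≗ (λ i → trans (cong (c i *_) (column≡0 i)) (ℚP.*-zeroʳ (c i))))
                      (sum-replicate-zero (suc k))
      (suc d) → combination≡0 d
  ... | no column≢0 with FinP.¬∀⟶∃¬ (suc k) _ (λ i → v i zero ≟ 0ℚ) column≢0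
  ...   | pivot , a≢0 = s≤s (linearlyIndependent⇒≤ _ (reduced-independent a≢0 independent))
    where open Elimination v pivot

module Counting where
  open import Data.Bool using (true; false)
  open import Data.Fin as Fin using (Fin; zero; suc)
  open import Data.List using (length; filter; tabulate)
  open import Data.Nat using (ℕ; zero; suc; _+_; _*_)
  import Data.Nat.Properties as ℕP
  open import Data.Product using (Σ; _×_; _,_)
  open import Data.Sum using (_⊎_; inj₁; inj₂)
  import Data.Sum.Properties as ⊎P
  open import Function using (_∘_)
  open import Relation.Binary.PropositionalEquality
  open import Relation.Nullary using (does; Dec; yes; no; contradiction)
  open import Relation.Unary using (Pred; Decidable)
  open import Algebra.Properties.CommutativeSemigroup ℕP.+-commutativeSemigroup using (interchange)
  open SemiringSum ℕP.+-*-semiring public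
    using (sum; sum-syntax; 𝟙; 𝟙-sym; ∑-𝟙≟; ∑-distrib-+; ∑-comm; sum-cong-≗; sum-replicate-zero)

  ∑-const : ∀ k x → ∑[ i < k ] x ≡ k * x
  ∑-const zero    x = refl
  ∑-const (suc k) x = cong (x +_) (∑-const k x)

  ∑-1 : ∀ k → ∑[ i < k ] 1 ≡ k
  ∑-1 k = trans (∑-const k 1) (ℕP.*-identityʳ k)

  length-filter-tabulate : ∀ {A : Set} {ℓ} {P : Pred A ℓ} (P? : Decidable P) {k} (f : Fin k → A) →
                           length (filter P? (tabulate f)) ≡ ∑[ i < k ] 𝟙 (P? (f i))
  length-filter-tabulate P? {zero}  f = refl
  length-filter-tabulate P? {suc k} f with does (P? (f zero))
  ... | true  = cong suc (length-filter-tabulate P? (f ∘ suc))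
  ... | false = length-filter-tabulate P? (f ∘ suc)

  _≟⊎_ : ∀ {p q} (x y : Fin p ⊎ Fin q) → Dec (x ≡ y)
  _≟⊎_ = ⊎P.≡-dec Fin._≟_ Fin._≟_

  module _ {p q : ℕ} where

    ∑⊎ : (Fin p ⊎ Fin q → ℕ) → ℕ
    ∑⊎ f = sum (f ∘ inj₁) + sum (f ∘ inj₂)

    ∑⊎-distrib-+ : ∀ f g → ∑⊎ (λ e → f e + g e) ≡ ∑⊎ f + ∑⊎ g
    ∑⊎-distrib-+ f g = trans (cong₂ _+_ (∑-distrib-+ (f ∘ inj₁) (g ∘ inj₁)) (∑-distrib-+ (f ∘ inj₂) (g ∘ inj₂)))
                             (interchange (sum (f ∘ inj₁)) (sum (g ∘ inj₁)) (sum (f ∘ inj₂)) (sum (g ∘ inj₂)))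

    ∑⊎-comm : ∀ {n} (f : Fin p ⊎ Fin q → Fin n → ℕ) →
              ∑⊎ (λ e → ∑[ v < n ] f e v) ≡ ∑[ v < n ] ∑⊎ (λ e → f e v)
    ∑⊎-comm f = trans (cong₂ _+_ (∑-comm (f ∘ inj₁)) (∑-comm (f ∘ inj₂)))
                      (sym (∑-distrib-+ (λ v → sum (λ a → f (inj₁ a) v)) (λ v → sum (λ j → f (inj₂ j) v))))

    ∑⊎-𝟙≟ : ∀ x → ∑⊎ (λ e → 𝟙 (e ≟⊎ x)) ≡ 1
    ∑⊎-𝟙≟ (inj₁ a) = cong₂ _+_ (∑-𝟙≟ a) (sum-replicate-zero q)
    ∑⊎-𝟙≟ (inj₂ j) = cong₂ _+_ (sum-replicate-zero p) (∑-𝟙≟ j)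

    module _ {n r : ℕ} (T : Fin p ⊎ Fin q → Fin n ⊎ Fin r) where

      TwoPreimages : Fin n ⊎ Fin r → Set
      TwoPreimages t = Σ (Fin p ⊎ Fin q) λ x → Σ (Fin p ⊎ Fin q) λ y →
        x ≢ y × T x ≡ t × T y ≡ t × (∀ z → T z ≡ t → z ≡ x ⊎ z ≡ y)

      ∑⊎-twoPreimages : ∀ {t} → TwoPreimages t → ∑⊎ (λ e → 𝟙 (T e ≟⊎ t)) ≡ 2
      ∑⊎-twoPreimages {t} (x , y , x≢y , Tx , Ty , only) = begin
        ∑⊎ (λ e → 𝟙 (T e ≟⊎ t))
          ≡⟨ cong₂ _+_ (sum-cong-≗ (split ∘ inj₁)) (sum-cong-≗ (split ∘ inj₂)) ⟩
        ∑⊎ (λ e → 𝟙 (e ≟⊎ x) + 𝟙 (e ≟⊎ y))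
          ≡⟨ ∑⊎-distrib-+ (λ e → 𝟙 (e ≟⊎ x)) (λ e → 𝟙 (e ≟⊎ y)) ⟩
        ∑⊎ (λ e → 𝟙 (e ≟⊎ x)) + ∑⊎ (λ e → 𝟙 (e ≟⊎ y))
          ≡⟨ cong₂ _+_ (∑⊎-𝟙≟ x) (∑⊎-𝟙≟ y) ⟩
        2 ∎
        where
        open ≡-Reasoning
        split : ∀ e → 𝟙 (T e ≟⊎ t) ≡ 𝟙 (e ≟⊎ x) + 𝟙 (e ≟⊎ y)
        split e with T e ≟⊎ t | e ≟⊎ x | e ≟⊎ y
        ... | yes _    | yes refl | yes refl = contradiction refl x≢y
        ... | yes _    | yes _    | no _     = refl
        ... | yes _    | no _     | yes _    = refl
        ... | yes Te≡t | no e≢x   | no e≢y with only e Te≡t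
        ...   | inj₁ e≡x = contradiction e≡x e≢x
        ...   | inj₂ e≡y = contradiction e≡y e≢y
        split e | no Te≢t | yes refl | _        = contradiction Tx Te≢t
        split e | no Te≢t | no _     | yes refl = contradiction Ty Te≢t
        split e | no _    | no _     | no _     = refl

      handshake : (∀ v → TwoPreimages (inj₁ v)) → ∑⊎ (λ e → ∑[ v < n ] 𝟙 (T e ≟⊎ inj₁ v)) ≡ n * 2
      handshake two = begin
        ∑⊎ (λ e → ∑[ v < n ] 𝟙 (T e ≟⊎ inj₁ v)) ≡⟨ ∑⊎-comm (λ e v → 𝟙 (T e ≟⊎ inj₁ v)) ⟩
        ∑[ v < n ] ∑⊎ (λ e → 𝟙 (T e ≟⊎ inj₁ v)) ≡⟨ sum-cong-≗ (λ v → ∑⊎-twoPreimages (two v)) ⟩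
        ∑[ v < n ] 2                            ≡⟨ ∑-const n 2 ⟩
        n * 2                                   ∎
        where open ≡-Reasoning

module Strings where
  open import Data.Fin using (zero; suc)
  open import Data.List using (List; []; _∷_; map; reverse; reverseAcc; _∷ʳ_; lookup)
  import Data.List.Properties as ListP
  import Data.List.Membership.Propositional.Properties as ∈P
  open import Data.List.Relation.Unary.All as All using (All)
  import Data.List.Relation.Unary.All.Properties as AllP
  open import Data.List.Relation.Unary.AllPairs using (_∷_)
  import Data.List.Relation.Unary.Any.Properties as AnyP
  open import Data.List.Relation.Unary.Linked as Linked using (Linked; []; [-]; _∷_)
  import Data.List.Relation.Unary.Linked.Properties as LinkedP
  open import Data.List.Relation.Unary.Unique.Propositional using (Unique)
  open import Data.Product using (∃; _,_)
  open import Data.Unit using (tt)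
  open import Function using (_∘_; flip)
  open import Relation.Binary.PropositionalEquality
  open import Relation.Nullary using (¬_; contradiction)

  module _ {A : Set} {R : A → A → Set} where

    Linked-reverseAcc : ∀ {x acc} xs → Linked (flip R) (x ∷ xs) → Linked R (x ∷ acc) →
                        Linked R (reverseAcc (x ∷ acc) xs)
    Linked-reverseAcc []       _           acc-linked = acc-linked
    Linked-reverseAcc (y ∷ ys) (Ryx ∷ lnk) acc-linked = Linked-reverseAcc ys lnk (Ryx ∷ acc-linked)

    Linked-reverse⁺ : ∀ {xs} → Linked (flip R) xs → Linked R (reverse xs)
    Linked-reverse⁺ {[]}     _   = []
    Linked-reverse⁺ {x ∷ xs} lnk = Linked-reverseAcc xs lnk [-]

  All-reverse⁺ : ∀ {A : Set} {P : A → Set} {xs} → All P xs → All P (reverse xs)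
  All-reverse⁺ pxs = All.tabulate (All.lookup pxs ∘ AnyP.reverse⁻)

  module Inversion (Q : Quiver) where

    flipL-involutive : ∀ l → flipL Q (flipL Q l) ≡ l
    flipL-involutive (dir _) = refl
    flipL-involutive (inv _) = refl

    inverse-involutive : ∀ w → inverse Q (inverse Q w) ≡ w
    inverse-involutive w = begin
      reverse (map (flipL Q) (reverse (map (flipL Q) w)))
        ≡⟨ cong reverse (ListP.reverse-map (flipL Q) (map (flipL Q) w)) ⟩
      reverse (reverse (map (flipL Q) (map (flipL Q) w)))
        ≡⟨ ListP.reverse-involutive _ ⟩
      map (flipL Q) (map (flipL Q) w)
        ≡⟨ sym (ListP.map-∘ w) ⟩
      map (flipL Q ∘ flipL Q) w
        ≡⟨ ListP.map-cong flipL-involutive w ⟩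
      map (λ l → l) w
        ≡⟨ ListP.map-id w ⟩
      w ∎
      where open ≡-Reasoning

    inverse-∷ : ∀ l w → inverse Q (l ∷ w) ≡ inverse Q w ∷ʳ flipL Q l
    inverse-∷ l w = ListP.unfold-reverse (flipL Q l) (map (flipL Q) w)

    inverse-∷ʳ : ∀ w l → inverse Q (w ∷ʳ l) ≡ flipL Q l ∷ inverse Q w
    inverse-∷ʳ w l = trans (cong reverse (ListP.map-++ (flipL Q) w (l ∷ [])))
                           (ListP.reverse-++ (map (flipL Q) w) (flipL Q l ∷ []))

    Step-flip : ∀ {l l′} → Step Q l l′ → Step Q (flipL Q l′) (flipL Q l)
    Step-flip {dir _} {dir _} (matching , allowed) = sym matching , allowed
    Step-flip {dir _} {inv _} (matching , allowed) = sym matching , allowed ∘ sym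
    Step-flip {inv _} {dir _} (matching , allowed) = sym matching , allowed ∘ sym
    Step-flip {inv _} {inv _} (matching , allowed) = sym matching , allowed

    inverse-linked : ∀ {w} → Linked (Step Q) w → Linked (Step Q) (inverse Q w)
    inverse-linked lnk = Linked-reverse⁺ (LinkedP.map⁺ (Linked.map Step-flip lnk))

    inverse-isString : ∀ {w} → IsString Q w → IsString Q (inverse Q w)
    inverse-isString {w} (w≢[] , lnk) = (λ eq → w≢[] (trans (sym (inverse-involutive w)) (cong (inverse Q) eq)))
                                      , inverse-linked lnk

    inverse-isRoute : ∀ {w} → IsRoute Q w → IsRoute Q (inverse Q w)
    inverse-isRoute {w} (string , maximal-end , maximal-start) =
      inverse-isString string , extend-end , extend-start
      where
      extend-end : ¬ ∃ λ l → IsString Q (inverse Q w ∷ʳ l)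
      extend-end (l , s) = maximal-start (flipL Q l , subst (IsString Q)
        (trans (inverse-∷ʳ (inverse Q w) l) (cong (flipL Q l ∷_) (inverse-involutive w))) (inverse-isString s))
      extend-start : ¬ ∃ λ l → IsString Q (l ∷ inverse Q w)
      extend-start (l , s) = maximal-end (flipL Q l , subst (IsString Q)
        (trans (inverse-∷ l (inverse Q w)) (cong (_∷ʳ flipL Q l) (inverse-involutive w))) (inverse-isString s))

    inverse-dir : ∀ {w} → All (IsDir Q) w → All (IsInv Q) (inverse Q w)
    inverse-dir dirs = All-reverse⁺ (AllP.map⁺ (All.map flip-dir dirs))
      where
      flip-dir : ∀ {l} → IsDir Q l → IsInv Q (flipL Q l)
      flip-dir {dir _} _ = tt

  lookup-injective : ∀ {A : Set} {xs : List A} → Unique xs → ∀ {i j} → lookup xs i ≡ lookup xs j → i ≡ j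
  lookup-injective (_   ∷ _) {zero}  {zero}  _  = refl
  lookup-injective (x∉ ∷ _) {zero}  {suc j} eq = contradiction eq (All.lookup x∉ (∈P.∈-lookup j))
  lookup-injective (x∉ ∷ _) {suc i} {zero}  eq = contradiction (sym eq) (All.lookup x∉ (∈P.∈-lookup i))
  lookup-injective (_   ∷ u) {suc i} {suc j} eq = cong suc (lookup-injective u eq)

module FringedQuiver {Λ : GentleAlgebra} (Λ~ : Fringing Λ) where
  open import Data.Bool using (true; false; if_then_else_)
  open import Data.Fin using (Fin)
  open import Data.List using (List; []; _∷_; length)
  open import Data.List.Relation.Unary.Linked using (Linked; []; [-]; _∷_)
  open import Data.Nat as ℕ using (zero; suc)
  import Data.Nat.Properties as ℕP
  open import Data.Product using (∃; _×_; _,_; proj₁; proj₂)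
  open import Data.Sum using (_⊎_; inj₁; inj₂)
  import Data.Sum.Properties as ⊎P
  open import Relation.Binary.PropositionalEquality
  open import Relation.Nullary using (contradiction)

  open GentleAlgebra Λ using (n; m; quiver; admissible)
  open Fringing Λ~
  open GentleLocal gentle~

  Tl Hd : E Λ~ → Fin n ⊎ Fin b
  Tl = fTl Λ b at out
  Hd = fHd Λ b at out

  tl-fringe : ∀ e {j} → Tl e ≡ inj₂ j → e ≡ inj₂ j × out j ≡ false
  tl-fringe (inj₂ j′) eq with out j′ in o
  tl-fringe (inj₂ j′) refl | false = refl , o

  hd-fringe : ∀ e {j} → Hd e ≡ inj₂ j → e ≡ inj₂ j × out j ≡ true
  hd-fringe (inj₂ j′) eq with out j′ in o
  hd-fringe (inj₂ j′) refl | true = refl , o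

  tl-inward : ∀ {j} → out j ≡ false → Tl (inj₂ j) ≡ inj₂ j
  tl-inward o rewrite o = refl

  hd-outward : ∀ {j} → out j ≡ true → Hd (inj₂ j) ≡ inj₂ j
  hd-outward o rewrite o = refl

  hd-internal⇒tl-fringe : ∀ {j v} → Hd (inj₂ j) ≡ inj₁ v → Tl (inj₂ j) ≡ inj₂ j
  hd-internal⇒tl-fringe {j} eq with out j
  ... | false = refl

  -- The unique arrow into the tail of β composing with β without relation; on arrows
  -- leaving a fringe vertex, where there is none, it is junk (β itself).
  pred : E Λ~ → E Λ~
  pred β = predAt (Tl β)
    where
    predAt : Fin n ⊎ Fin b → E Λ~
    predAt (inj₂ _) = β
    predAt (inj₁ v) with in=2 v
    ... | x , y , _ = if Rel~ x β then y else x

  pred-spec : ∀ β {v} → Tl β ≡ inj₁ v → Hd (pred β) ≡ inj₁ v × Rel~ (pred β) β ≡ false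
  pred-spec β {v} tβ rewrite tβ with in=2 v
  ... | x , y , x≢y , hx , hy , _ with Rel~ x β in rx
  ...   | false = hx , rx
  ...   | true with Rel~ y β in ry
  ...     | false = hy , refl
  ...     | true = contradiction (pre-rel β x y (trans hx (sym tβ)) (trans hy (sym tβ)) rx ry) x≢y

  pred-hd : ∀ β {v} → Tl β ≡ inj₁ v → Hd (pred β) ≡ inj₁ v
  pred-hd β tβ = proj₁ (pred-spec β tβ)

  pred-nonrel : ∀ β {v} → Tl β ≡ inj₁ v → Rel~ (pred β) β ≡ false
  pred-nonrel β tβ = proj₂ (pred-spec β tβ)

  pred-unique : ∀ α β {v} → Tl β ≡ inj₁ v → Hd α ≡ inj₁ v → Rel~ α β ≡ false → α ≡ pred β
  pred-unique α β tβ hα rα =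
    pre-nonrel β α (pred β) (trans hα (sym tβ)) (trans (pred-hd β tβ) (sym tβ)) rα (pred-nonrel β tβ)

  succ-exists : ∀ β {v} → Hd β ≡ inj₁ v → ∃ λ γ → Tl γ ≡ inj₁ v × Rel~ β γ ≡ false
  succ-exists β {v} hβ with out=2 v
  ... | x , y , x≢y , tx , ty , _ with Rel~ β x in rx
  ...   | false = x , tx , rx
  ...   | true with Rel~ β y in ry
  ...     | false = y , ty , ry
  ...     | true = contradiction (post-rel β x y (trans tx (sym hβ)) (trans ty (sym hβ)) rx ry) x≢y

  data Reaches : E Λ~ → Set where
    fringe : ∀ {β j} → Tl β ≡ inj₂ j → Reaches β
    step   : ∀ {β v} → Tl β ≡ inj₁ v → Reaches (pred β) → Reaches β

  foldReaches : ∀ {A : Set} → (E Λ~ → Fin b → A) → (E Λ~ → Fin n → A → A) →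
                ∀ {β} → Reaches β → A
  foldReaches f g (fringe {β} {j} _) = f β j
  foldReaches f g (step {β} {v} _ r) = g β v (foldReaches f g r)

  foldReaches-irrelevant : ∀ {A : Set} (f : E Λ~ → Fin b → A) (g : E Λ~ → Fin n → A → A) →
    ∀ {β} (r r′ : Reaches β) → foldReaches f g r ≡ foldReaches f g r′
  foldReaches-irrelevant f g (fringe t) (fringe t′) with trans (sym t) t′
  ... | refl = refl
  foldReaches-irrelevant f g (fringe t) (step t′ _) with trans (sym t) t′
  ... | ()
  foldReaches-irrelevant f g (step t _) (fringe t′) with trans (sym t) t′
  ... | ()
  foldReaches-irrelevant f g (step t r) (step t′ r′) with trans (sym t) t′
  ... | refl = cong (g _ _) (foldReaches-irrelevant f g r r′)

  private
    NonRelPath : List (Fin m) → Set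
    NonRelPath = Linked (NonRelStep quiver)

  pred-fringe⇒reaches : ∀ β {v j} → Tl β ≡ inj₁ v → pred β ≡ inj₂ j → Reaches (pred β)
  pred-fringe⇒reaches β tβ eq =
    fringe (trans (cong Tl eq) (hd-internal⇒tl-fringe (trans (cong Hd (sym eq)) (pred-hd β tβ))))

  -- Admissibility bounds the length of the path in the second alternative.
  reaches-or-prolongs : ∀ f a l → NonRelPath (a ∷ l) →
    Reaches (inj₁ a) ⊎ ∃ λ p → length p ≡ f ℕ.+ length (a ∷ l) × NonRelPath p
  reaches-or-prolongs zero    a l path = inj₂ (a ∷ l , refl , path)
  reaches-or-prolongs (suc f) a l path with pred (inj₁ a) in eq
  ... | inj₂ j = inj₁ (step refl (pred-fringe⇒reaches (inj₁ a) refl eq))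
  ... | inj₁ a′ with reaches-or-prolongs f a′ (a ∷ l) (nonRel ∷ path)
    where
    nonRel : NonRelStep quiver a′ a
    nonRel = ⊎P.inj₁-injective (trans (cong Hd (sym eq)) (pred-hd (inj₁ a) refl))
           , trans (sym (extends a′ a))
                   (trans (cong (λ α → Rel~ α (inj₁ a)) (sym eq)) (pred-nonrel (inj₁ a) refl))
  ...   | inj₁ r = inj₁ (step refl (subst Reaches (sym eq) r))
  ...   | inj₂ (p , len , p-path) = inj₂ (p , trans len (ℕP.+-suc f (length (a ∷ l))) , p-path)

  reaches-Q : ∀ a → Reaches (inj₁ a)
  reaches-Q a with admissible
  ... | zero  , bounded = contradiction [] (bounded [] refl)
  ... | suc N , bounded with reaches-or-prolongs N a [] [-]
  ...   | inj₁ r = r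
  ...   | inj₂ (p , len , path) = contradiction path (bounded p (trans len (ℕP.+-comm N 1)))

  reaches : ∀ β → Reaches β
  reaches β with Tl β in tβ
  ... | inj₂ j = fringe tβ
  ... | inj₁ v with pred β in eq
  ...   | inj₁ a = step tβ (subst Reaches (sym eq) (reaches-Q a))
  ...   | inj₂ j = step tβ (pred-fringe⇒reaches β tβ eq)

  foldReaches-fringe : ∀ {A : Set} (f : E Λ~ → Fin b → A) (g : E Λ~ → Fin n → A → A) →
    ∀ {β j} → Tl β ≡ inj₂ j → (r : Reaches β) → foldReaches f g r ≡ f β j
  foldReaches-fringe f g tβ r = foldReaches-irrelevant f g r (fringe tβ)

  foldReaches-step : ∀ {A : Set} (f : E Λ~ → Fin b → A) (g : E Λ~ → Fin n → A → A) →
    ∀ {β v} → Tl β ≡ inj₁ v → (r : Reaches β) →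
    foldReaches f g r ≡ g β v (foldReaches f g (reaches (pred β)))
  foldReaches-step f g tβ r = foldReaches-irrelevant f g r (step tβ (reaches _))

  foldReaches-preserves : ∀ {A : Set} (P : A → Set) {f : E Λ~ → Fin b → A} {g : E Λ~ → Fin n → A → A} →
    (∀ β j → P (f β j)) → (∀ β v {x} → P x → P (g β v x)) → ∀ {β} (r : Reaches β) → P (foldReaches f g r)
  foldReaches-preserves P Pf Pg (fringe _) = Pf _ _
  foldReaches-preserves P Pf Pg (step _ r) = Pg _ _ (foldReaches-preserves P Pf Pg r)

  reaches-inward : ∀ {β} → Reaches β → ∃ λ j → out j ≡ false
  reaches-inward (fringe {β} tβ) = _ , proj₂ (tl-fringe β tβ)
  reaches-inward (step _ r)      = reaches-inward r

module Flows {Λ : GentleAlgebra} (Λ~ : Fringing Λ) where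
  open import Data.Bool using (true; false)
  open import Data.Fin using (Fin)
  open import Data.Product using (∃; _,_; proj₁; proj₂)
  open import Data.Rational using (ℚ; 0ℚ; _+_; _-_; _*_; _≤_)
  import Data.Rational.Properties as ℚP
  open import Data.Sum using (inj₁; inj₂)
  open import Function using (_∘_)
  open import Relation.Binary.PropositionalEquality
  open import Relation.Nullary using (yes; no; contradiction)
  open import Tactic.RingSolver using (solve-∀)
  open RationalArithmetic
  open Counting using (_≟⊎_)

  open GentleAlgebra Λ using (n)
  open Fringing Λ~
  open GentleLocal gentle~
  open FringedQuiver Λ~

  Conserves : (E Λ~ → ℚ) → Set
  Conserves h = ∀ α₁ α₂ β₁ β₂ → Rel~ α₁ α₂ ≡ true → Rel~ β₁ β₂ ≡ true → Hd α₁ ≡ Hd β₁ →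
                h α₁ + h α₂ ≡ h β₁ + h β₂

  Increments : (Fin n → ℚ) → (E Λ~ → ℚ) → Set
  Increments d h = ∀ β {v} → Tl β ≡ inj₁ v → h β ≡ h (pred β) + d v

  relation-internal : ∀ {α β} → Rel~ α β ≡ true → ∃ λ v → Tl β ≡ inj₁ v
  relation-internal {α} {β} r with Tl β in tβ
  ... | inj₁ v = v , refl
  ... | inj₂ j = contradiction (trans (sym (proj₂ (hd-fringe α (trans (wf~ α β r) tβ))))
                                      (proj₂ (tl-fringe β tβ))) λ ()

  -- At a vertex with relations α₁α₂ and β₁β₂, the non-relation compositions are β₁α₂ and α₁β₂.
  pred-of-relation : ∀ {α α′ β v} → Rel~ α β ≡ true → Tl β ≡ inj₁ v → Hd α′ ≡ inj₁ v →
                     α ≢ α′ → pred β ≡ α′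
  pred-of-relation {α} {α′} {β} r tβ hα′ α≢α′
    with in≤2 _ (pred β) α α′ (pred-hd β tβ) (trans (wf~ α β r) tβ) hα′
  ... | inj₁ pred≡α         = contradiction (trans (sym r) (trans (cong (λ γ → Rel~ γ β) (sym pred≡α))
                                (pred-nonrel β tβ))) λ ()
  ... | inj₂ (inj₁ pred≡α′) = pred≡α′
  ... | inj₂ (inj₂ α≡α′)    = contradiction α≡α′ α≢α′

  increments⇒conserves : ∀ {d h} → Increments d h → Conserves h
  increments⇒conserves {d} {h} inc α₁ α₂ β₁ β₂ r₁ r₂ hα₁≡hβ₁ with relation-internal r₁ | α₁ ≟⊎ β₁
  ... | v , tα₂ | yes refl =
    cong (λ γ → h α₁ + h γ) (post-rel α₁ α₂ β₂ (sym (wf~ α₁ α₂ r₁)) (sym (wf~ α₁ β₂ r₂)) r₁ r₂)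
  ... | v , tα₂ | no α₁≢β₁ = begin
    h α₁ + h α₂                ≡⟨ cong (h α₁ +_) (inc α₂ tα₂) ⟩
    h α₁ + (h (pred α₂) + d v) ≡⟨ cong (λ γ → h α₁ + (h γ + d v)) pred-α₂ ⟩
    h α₁ + (h β₁ + d v)        ≡⟨ swap (h α₁) (h β₁) (d v) ⟩
    h β₁ + (h α₁ + d v)        ≡⟨ cong (λ γ → h β₁ + (h γ + d v)) (sym pred-β₂) ⟩
    h β₁ + (h (pred β₂) + d v) ≡⟨ cong (h β₁ +_) (sym (inc β₂ tβ₂)) ⟩
    h β₁ + h β₂                ∎
    where
    open ≡-Reasoning
    hα₁ : Hd α₁ ≡ inj₁ v
    hα₁ = trans (wf~ α₁ α₂ r₁) tα₂
    hβ₁ : Hd β₁ ≡ inj₁ v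
    hβ₁ = trans (sym hα₁≡hβ₁) hα₁
    tβ₂ : Tl β₂ ≡ inj₁ v
    tβ₂ = trans (sym (wf~ β₁ β₂ r₂)) hβ₁
    pred-α₂ : pred α₂ ≡ β₁
    pred-α₂ = pred-of-relation r₁ tα₂ hβ₁ α₁≢β₁
    pred-β₂ : pred β₂ ≡ α₁
    pred-β₂ = pred-of-relation r₂ tβ₂ hα₁ (α₁≢β₁ ∘ sym)
    swap : ∀ x y z → x + (y + z) ≡ y + (x + z)
    swap = solve-∀ ℚ-ring

  outArrow : Fin n → E Λ~
  outArrow v = proj₁ (out=2 v)

  outArrow-tl : ∀ v → Tl (outArrow v) ≡ inj₁ v
  outArrow-tl v = proj₁ (proj₂ (proj₂ (proj₂ (out=2 v))))

  -- The increment of h at v; by conserves⇒increments it does not depend on the outgoing arrow.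
  Δ : Fin n → (E Λ~ → ℚ) → ℚ
  Δ v h = h (outArrow v) - h (pred (outArrow v))

  conserves⇒increments : ∀ {h} → Conserves h → Increments (λ v → Δ v h) h
  conserves⇒increments {h} cons β {v} tβ with β ≟⊎ outArrow v
  ... | yes refl = cancel (h β) (h (pred β))
    where
    cancel : ∀ x y → x ≡ y + (x - y)
    cancel = solve-∀ ℚ-ring
  ... | no β≢γ = isolate (h p) (h β) (h π) (h γ) (cons p β π γ rel-pβ rel-πγ (trans hp (sym hπ)))
    where
    γ p π : E Λ~
    γ = outArrow v
    p = pred γ
    π = pred β
    tγ : Tl γ ≡ inj₁ v
    tγ = outArrow-tl v
    hp : Hd p ≡ inj₁ v
    hp = pred-hd γ tγ
    hπ : Hd π ≡ inj₁ v
    hπ = pred-hd β tβ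
    rel-pβ : Rel~ p β ≡ true
    rel-pβ with Rel~ p β in eq
    ... | true  = refl
    ... | false = contradiction (post-nonrel p β γ (trans tβ (sym hp)) (trans tγ (sym hp)) eq
                                   (pred-nonrel γ tγ)) β≢γ
    rel-πγ : Rel~ π γ ≡ true
    rel-πγ with Rel~ π γ in eq
    ... | true  = refl
    ... | false = contradiction (trans (sym rel-pβ) (subst (λ α → Rel~ α β ≡ false) π≡p (pred-nonrel β tβ))) λ ()
      where
      π≡p : π ≡ p
      π≡p = pre-nonrel γ π p (trans hπ (sym tγ)) (trans hp (sym tγ)) eq (pred-nonrel γ tγ)
    isolate : ∀ a b c d → a + b ≡ c + d → b ≡ c + (d - a)
    isolate a b c d eq = trans (left a b) (trans (cong (_- a) eq) (right c d a))
      where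
      left : ∀ a b → b ≡ (a + b) - a
      left = solve-∀ ℚ-ring
      right : ∀ c d a → (c + d) - a ≡ c + (d - a)
      right = solve-∀ ℚ-ring

  conserves-zero : ∀ {h} → Conserves h → (∀ v → Δ v h ≡ 0ℚ) →
                   (∀ j → out j ≡ false → h (inj₂ j) ≡ 0ℚ) → ∀ β → h β ≡ 0ℚ
  conserves-zero {h} cons Δ≡0 source≡0 β = go (reaches β)
    where
    go : ∀ {β} → Reaches β → h β ≡ 0ℚ
    go (fringe {β} tβ) with tl-fringe β tβ
    ... | refl , o = source≡0 _ o
    go (step {β} tβ r) = trans (conserves⇒increments {h} cons β tβ) (cong₂ _+_ (go r) (Δ≡0 _))

  module _ (ν : Fin n → ℚ) (σ : Fin b → ℚ) where

    flowWith : E Λ~ → ℚ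
    flowWith β = foldReaches (λ _ j → σ j) (λ _ v x → x + ν v) (reaches β)

    flowWith-increments : Increments ν flowWith
    flowWith-increments β tβ = foldReaches-step _ _ tβ (reaches β)

    flowWith-conserves : Conserves flowWith
    flowWith-conserves = increments⇒conserves flowWith-increments

    flowWith-source : ∀ {j} → out j ≡ false → flowWith (inj₂ j) ≡ σ j
    flowWith-source o = foldReaches-fringe _ _ (tl-inward o) (reaches _)

    Δ-flowWith : ∀ v → Δ v flowWith ≡ ν v
    Δ-flowWith v = trans (cong (_- flowWith (pred γ)) (flowWith-increments γ (outArrow-tl v)))
                         (cancel (flowWith (pred γ)) (ν v))
      where
      γ : E Λ~
      γ = outArrow v
      cancel : ∀ x y → (x + y) - x ≡ y
      cancel = solve-∀ ℚ-ring

    flowWith-nonneg : (∀ v → 0ℚ ≤ ν v) → (∀ j → 0ℚ ≤ σ j) → ∀ β → 0ℚ ≤ flowWith β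
    flowWith-nonneg ν≥0 σ≥0 β =
      foldReaches-preserves (0ℚ ≤_) (λ _ j → σ≥0 j) (λ _ v x≥0 → ℚP.+-mono-≤ x≥0 (ν≥0 v)) (reaches β)

  combination : ∀ {k} → (Fin k → ℚ) → (Fin k → E Λ~ → ℚ) → E Λ~ → ℚ
  combination {k} c p e = ∑[ i < k ] (c i * p i e)

  combination-conserves : ∀ {k} (c : Fin k → ℚ) (p : Fin k → E Λ~ → ℚ) →
    (∀ i → Conserves (p i)) → Conserves (combination c p)
  combination-conserves {k} c p cons α₁ α₂ β₁ β₂ r₁ r₂ h = begin
    combination c p α₁ + combination c p α₂
      ≡⟨ sym (∑-distrib-+ (λ i → c i * p i α₁) (λ i → c i * p i α₂)) ⟩
    ∑[ i < k ] (c i * p i α₁ + c i * p i α₂)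
      ≡⟨ sum-cong-≗ (λ i → trans (sym (ℚP.*-distribˡ-+ (c i) (p i α₁) (p i α₂)))
                          (trans (cong (c i *_) (cons i α₁ α₂ β₁ β₂ r₁ r₂ h))
                                 (ℚP.*-distribˡ-+ (c i) (p i β₁) (p i β₂)))) ⟩
    ∑[ i < k ] (c i * p i β₁ + c i * p i β₂)
      ≡⟨ ∑-distrib-+ (λ i → c i * p i β₁) (λ i → c i * p i β₂) ⟩
    combination c p β₁ + combination c p β₂ ∎
    where open ≡-Reasoning

  Δ-combination : ∀ {k} (c : Fin k → ℚ) (p : Fin k → E Λ~ → ℚ) v →
    Δ v (combination c p) ≡ ∑[ i < k ] (c i * Δ v (p i))
  Δ-combination {k} c p v = trans (sym (∑-distrib-difference (λ i → c i * p i γ) (λ i → c i * p i (pred γ))))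
                                  (sum-cong-≗ (λ i → factor (c i) (p i γ) (p i (pred γ))))
    where
    γ : E Λ~
    γ = outArrow v
    factor : ∀ x y z → x * y - x * z ≡ x * (y - z)
    factor = solve-∀ ℚ-ring

  scaled-conserves : ∀ h t → Conserves h → Conserves (λ e → h e * t)
  scaled-conserves h t cons α₁ α₂ β₁ β₂ r₁ r₂ eq =
    trans (sym (ℚP.*-distribʳ-+ t (h α₁) (h α₂)))
          (trans (cong (_* t) (cons α₁ α₂ β₁ β₂ r₁ r₂ eq)) (ℚP.*-distribʳ-+ t (h β₁) (h β₂)))

module FringeArrows {Λ : GentleAlgebra} (Λ~ : Fringing Λ) where
  open import Data.Bool as Bool using (Bool; true; false)
  open import Data.Fin using (Fin)
  open import Data.List using (List; length; filter; allFin; lookup)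
  open import Data.List.Membership.Propositional using (_∈_)
  import Data.List.Membership.Propositional.Properties as ∈P
  import Data.List.Relation.Unary.Any as Any
  import Data.List.Relation.Unary.Any.Properties as AnyP
  open import Data.List.Relation.Unary.Unique.Propositional using (Unique)
  import Data.List.Relation.Unary.Unique.Propositional.Properties as UniqueP
  open import Data.Nat using (ℕ; _+_; _*_)
  import Data.Nat.Properties as ℕP
  import Data.Nat.Tactic.RingSolver as ℕ-Solver
  open import Data.Product using (∃; _,_; proj₂)
  open import Data.Sum using (_⊎_; inj₁; inj₂)
  open import Function using (_∘_)
  open import Relation.Binary.PropositionalEquality
  open Counting
  open Strings using (lookup-injective)

  open GentleAlgebra Λ using (n; m; tl; hd)
  open Fringing Λ~
  open FringedQuiver Λ~

  fringeArrows : Bool → List (Fin b)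
  fringeArrows d = filter (λ j → out j Bool.≟ d) (allFin b)

  fringeArrows-sound : ∀ d {j} → j ∈ fringeArrows d → out j ≡ d
  fringeArrows-sound d = proj₂ ∘ ∈P.∈-filter⁻ (λ j → out j Bool.≟ d) {xs = allFin b}

  fringeArrows-complete : ∀ d {j} → out j ≡ d → j ∈ fringeArrows d
  fringeArrows-complete d {j} = ∈P.∈-filter⁺ (λ j → out j Bool.≟ d) (∈P.∈-allFin j)

  fringeArrows-unique : ∀ d → Unique (fringeArrows d)
  fringeArrows-unique d = UniqueP.filter⁺ (λ j → out j Bool.≟ d) (UniqueP.allFin⁺ b)

  length-fringeArrows : ∀ d → length (fringeArrows d) ≡ ∑[ j < b ] 𝟙 (out j Bool.≟ d)
  length-fringeArrows d = length-filter-tabulate (λ j → out j Bool.≟ d) (λ j → j)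

  outward inward : List (Fin b)
  outward = fringeArrows true
  inward  = fringeArrows false

  s : ℕ
  s = length inward

  source : Fin s → Fin b
  source = lookup inward

  source-inward : ∀ k → out (source k) ≡ false
  source-inward k = fringeArrows-sound false (∈P.∈-lookup k)

  source-injective : ∀ {k k′} → source k ≡ source k′ → k ≡ k′
  source-injective = lookup-injective (fringeArrows-unique false)

  source-surjective : ∀ {j} → out j ≡ false → ∃ λ k → source k ≡ j
  source-surjective {j} o = Any.index j∈ , sym (AnyP.lookup-index j∈)
    where
    j∈ : j ∈ inward
    j∈ = fringeArrows-complete false o

  private
    ∑-𝟙-inj₁ : ∀ w → ∑[ v < n ] 𝟙 (inj₁ {B = Fin b} w ≟⊎ inj₁ v) ≡ 1
    ∑-𝟙-inj₁ w = trans (sum-cong-≗ (λ v → 𝟙-sym w v)) (∑-𝟙≟ w)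

    ∑-𝟙-inj₂ : ∀ j → ∑[ v < n ] 𝟙 (inj₂ j ≟⊎ inj₁ {B = Fin b} v) ≡ 0
    ∑-𝟙-inj₂ j = sum-replicate-zero n

    endpoint-count : ∀ (T : E Λ~ → Fin n ⊎ Fin b) (t : Fin m → Fin n) (d : Bool) →
      (∀ v → TwoPreimages T (inj₁ v)) → (∀ a → T (inj₁ a) ≡ inj₁ (t a)) →
      (∀ j → 𝟙 (out j Bool.≟ d) ≡ ∑[ v < n ] 𝟙 (T (inj₂ j) ≟⊎ inj₁ v)) →
      m + length (fringeArrows d) ≡ n * 2
    endpoint-count T t d two T-Q T-fringe = begin
      m + length (fringeArrows d)
        ≡⟨ cong₂ _+_ (sym (∑-1 m)) (length-fringeArrows d) ⟩
      ∑[ a < m ] 1 + ∑[ j < b ] 𝟙 (out j Bool.≟ d)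
        ≡⟨ cong₂ _+_ (sum-cong-≗ (λ a → sym (trans (cong (λ x → ∑[ v < n ] 𝟙 (x ≟⊎ inj₁ v)) (T-Q a))
                                                   (∑-𝟙-inj₁ (t a)))))
                     (sum-cong-≗ T-fringe) ⟩
      ∑⊎ (λ e → ∑[ v < n ] 𝟙 (T e ≟⊎ inj₁ v))
        ≡⟨ handshake T two ⟩
      n * 2 ∎
      where open ≡-Reasoning

  tail-count : m + length outward ≡ n * 2
  tail-count = endpoint-count Tl tl true out=2 (λ _ → refl) tail-internal
    where
    tail-internal : ∀ j → 𝟙 (out j Bool.≟ true) ≡ ∑[ v < n ] 𝟙 (Tl (inj₂ j) ≟⊎ inj₁ v)
    tail-internal j with out j
    ... | true  = sym (∑-𝟙-inj₁ (at j))
    ... | false = sym (∑-𝟙-inj₂ j)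

  head-count : m + length inward ≡ n * 2
  head-count = endpoint-count Hd hd false in=2 (λ _ → refl) head-internal
    where
    head-internal : ∀ j → 𝟙 (out j Bool.≟ false) ≡ ∑[ v < n ] 𝟙 (Hd (inj₂ j) ≟⊎ inj₁ v)
    head-internal j with out j
    ... | true  = sym (∑-𝟙-inj₂ j)
    ... | false = sym (∑-𝟙-inj₁ (at j))

  fringe-count : length inward + length outward ≡ b
  fringe-count = begin
    length inward + length outward
      ≡⟨ cong₂ _+_ (length-fringeArrows false) (length-fringeArrows true) ⟩
    ∑[ j < b ] 𝟙 (out j Bool.≟ false) + ∑[ j < b ] 𝟙 (out j Bool.≟ true)
      ≡⟨ sym (∑-distrib-+ (λ j → 𝟙 (out j Bool.≟ false)) (λ j → 𝟙 (out j Bool.≟ true))) ⟩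
    ∑[ j < b ] (𝟙 (out j Bool.≟ false) + 𝟙 (out j Bool.≟ true))
      ≡⟨ sum-cong-≗ (λ j → one-direction (out j)) ⟩
    ∑[ j < b ] 1
      ≡⟨ ∑-1 b ⟩
    b ∎
    where
    open ≡-Reasoning
    one-direction : ∀ x → 𝟙 (x Bool.≟ false) + 𝟙 (x Bool.≟ true) ≡ 1
    one-direction true  = refl
    one-direction false = refl

  outward≡s : length outward ≡ s
  outward≡s = ℕP.+-cancelˡ-≡ m _ _ (trans tail-count (sym head-count))

  arrows-count : m + b ≡ n + (n + s)
  arrows-count = begin
    m + b                    ≡⟨ cong (m +_) (sym fringe-count) ⟩
    m + (s + length outward) ≡⟨ regroup m s (length outward) ⟩
    (m + length outward) + s ≡⟨ cong (_+ s) tail-count ⟩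
    n * 2 + s                ≡⟨ double n s ⟩
    n + (n + s)              ∎
    where
    open ≡-Reasoning
    regroup : ∀ x y z → x + (y + z) ≡ (x + z) + y
    regroup = ℕ-Solver.solve-∀
    double : ∀ x y → x * 2 + y ≡ x + (x + y)
    double = ℕ-Solver.solve-∀

module StraightRoutes {Λ : GentleAlgebra} (Λ~ : Fringing Λ) where
  open import Data.Bool using (true)
  open import Data.Bool.Properties using (¬-not)
  open import Data.List using (List; []; _∷_; length; map; _∷ʳ_)
  import Data.List.Properties as ListP
  open import Data.List.Membership.Propositional using (_∈_)
  import Data.List.Membership.Propositional.Properties as ∈P
  open import Data.List.Relation.Unary.All as All using (All; _∷_)
  import Data.List.Relation.Unary.All.Properties as AllP
  open import Data.List.Relation.Unary.AllPairs as AllPairs using (AllPairs)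
  import Data.List.Relation.Unary.AllPairs.Properties as AllPairsP
  open import Data.List.Relation.Unary.Any using (here)
  open import Data.List.Relation.Unary.Linked as Linked using (Linked; [-]; _∷_)
  open import Data.Product using (∃; _×_; _,_; proj₁; proj₂)
  open import Data.Sum using (_⊎_; inj₁; inj₂)
  open import Data.Unit using (tt)
  open import Function using (_∘_)
  open import Relation.Binary.PropositionalEquality
  open import Relation.Nullary using (¬_; contradiction)

  open Fringing Λ~
  open FringedQuiver Λ~
  open FringeArrows Λ~ using (fringeArrows-sound; fringeArrows-complete; fringeArrows-unique; outward; s; outward≡s)
  open Strings using (module Inversion)
  open Inversion quiver~

  stringOf : ∀ {β} → Reaches β → List (Letter (E Λ~))
  stringOf = foldReaches (λ β _ → inv β ∷ []) (λ β _ w → inv β ∷ w)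

  stringOf-∷ : ∀ {β} (r : Reaches β) → ∃ λ w → stringOf r ≡ inv β ∷ w
  stringOf-∷ (fringe _) = [] , refl
  stringOf-∷ (step _ r) = stringOf r , refl

  pred-step : ∀ β {v} → Tl β ≡ inj₁ v → Step quiver~ (inv β) (inv (pred β))
  pred-step β tβ = trans tβ (sym (pred-hd β tβ)) , λ r → contradiction (trans (sym r) (pred-nonrel β tβ)) λ ()

  stringOf-linked : ∀ {β} (r : Reaches β) → Linked (Step quiver~) (stringOf r)
  stringOf-linked (fringe _)       = [-]
  stringOf-linked (step {β} tβ r) = prepend r (stringOf-linked r)
    where
    prepend : (r : Reaches (pred β)) → Linked (Step quiver~) (stringOf r) →
              Linked (Step quiver~) (inv β ∷ stringOf r)
    prepend (fringe _) _   = pred-step β tβ ∷ [-]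
    prepend (step _ _) lnk = pred-step β tβ ∷ lnk

  stringOf-inv : ∀ {β} (r : Reaches β) → All (IsInv quiver~) (stringOf r)
  stringOf-inv (fringe _) = tt ∷ All.[]
  stringOf-inv (step _ r) = tt ∷ stringOf-inv r

  fringe-no-step : ∀ {β j} → Tl β ≡ inj₂ j → ∀ l → ¬ Step quiver~ (inv β) l
  fringe-no-step {β} tβ (dir a) (matching , allowed) =
    allowed (trans (proj₁ (tl-fringe β tβ)) (sym (proj₁ (tl-fringe a (trans (sym matching) tβ)))))
  fringe-no-step {β} tβ (inv a) (matching , _) =
    contradiction (trans (sym (proj₂ (hd-fringe a (trans (sym matching) tβ)))) (proj₂ (tl-fringe β tβ))) λ ()

  stringOf-maximal-end : ∀ {β} (r : Reaches β) l → ¬ Linked (Step quiver~) (stringOf r ∷ʳ l)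
  stringOf-maximal-end (fringe tβ) l (s ∷ [-]) = fringe-no-step tβ l s
  stringOf-maximal-end (step _ r)  l lnk       = stringOf-maximal-end r l (Linked.tail lnk)

  outward-maximal-start : ∀ {j} → out j ≡ true → ∀ l w → ¬ Linked (Step quiver~) (l ∷ inv (inj₂ j) ∷ w)
  outward-maximal-start o (dir a) w ((matching , allowed) ∷ _) =
    allowed (proj₁ (hd-fringe a (trans matching (hd-outward o))))
  outward-maximal-start o (inv a) w ((matching , _) ∷ _) =
    contradiction (trans (sym o) (proj₂ (tl-fringe a (trans matching (hd-outward o))))) λ ()

  maximal-start⇒outward : ∀ β w → (∀ l → ¬ Linked (Step quiver~) (l ∷ inv β ∷ w)) →
    Linked (Step quiver~) (inv β ∷ w) → ∃ λ j → β ≡ inj₂ j × out j ≡ true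
  maximal-start⇒outward β w maximal lnk with Hd β in hβ
  ... | inj₂ j = j , hd-fringe β hβ
  ... | inj₁ v with succ-exists β hβ
  ...   | γ , tγ , rγ =
    contradiction ((trans tγ (sym hβ) , λ r → contradiction (trans (sym r) rγ) λ ()) ∷ lnk) (maximal (inv γ))

  maximal-inverse⇒stringOf : ∀ β w → Linked (Step quiver~) (inv β ∷ w) → All (IsInv quiver~) w →
    (∀ l → ¬ Linked (Step quiver~) ((inv β ∷ w) ∷ʳ l)) → ∃ λ (r : Reaches β) → stringOf r ≡ inv β ∷ w
  maximal-inverse⇒stringOf β [] _ _ maximal with Tl β in tβ
  ... | inj₂ j = fringe tβ , refl
  ... | inj₁ v = contradiction (pred-step β tβ ∷ [-]) (maximal (inv (pred β)))
  maximal-inverse⇒stringOf β (inv α ∷ w) ((matching , allowed) ∷ lnk) (_ ∷ invs) maximal with Tl β in tβ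
  ... | inj₂ j = contradiction (trans (sym (proj₂ (hd-fringe α (sym matching))))
                                      (proj₂ (tl-fringe β tβ))) λ ()
  ... | inj₁ v with pred-unique α β tβ (sym matching) (¬-not allowed)
  ...   | refl with maximal-inverse⇒stringOf α w lnk invs (λ l → maximal l ∘ (pred-step β tβ ∷_))
  ...     | r , eq = step tβ r , cong (inv β ∷_) eq

  backString : E Λ~ → List (Letter (E Λ~))
  backString β = stringOf (reaches β)

  straightRoutes : List (List (Letter (E Λ~)))
  straightRoutes = map (backString ∘ inj₂) outward

  backString-straight : ∀ {j} → out j ≡ true → IsStraightRoute quiver~ (backString (inj₂ j))
  backString-straight {j} o with stringOf-∷ (reaches (inj₂ j))
  ... | w , eq = ((nonempty , stringOf-linked r) , no-end , no-start) , inj₂ (stringOf-inv r)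
    where
    r : Reaches (inj₂ j)
    r = reaches (inj₂ j)
    nonempty : stringOf r ≢ []
    nonempty e with trans (sym eq) e
    ... | ()
    no-end : ¬ ∃ λ l → IsString quiver~ (stringOf r ∷ʳ l)
    no-end (l , _ , lnk) = stringOf-maximal-end r l lnk
    no-start : ¬ ∃ λ l → IsString quiver~ (l ∷ stringOf r)
    no-start (l , _ , lnk) = outward-maximal-start o l w (subst (λ p → Linked (Step quiver~) (l ∷ p)) eq lnk)

  inverse-route∈straightRoutes : ∀ {w} → IsRoute quiver~ w → All (IsInv quiver~) w → w ∈ straightRoutes
  inverse-route∈straightRoutes {[]} ((nonempty , _) , _) _ = contradiction refl nonempty
  inverse-route∈straightRoutes {inv β ∷ w} ((_ , lnk) , no-end , no-start) (_ ∷ invs)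
    with maximal-start⇒outward β w (λ l lnk′ → no-start (l , (λ ()) , lnk′)) lnk
  ... | j , refl , o with maximal-inverse⇒stringOf (inj₂ j) w lnk invs (λ l lnk′ → no-end (l , (λ ()) , lnk′))
  ...   | r , eq = subst (_∈ straightRoutes) (trans (sym (foldReaches-irrelevant _ _ r (reaches (inj₂ j)))) eq)
                     (∈P.∈-map⁺ (backString ∘ inj₂) (fringeArrows-complete true o))

  straightRoutes-complete : ∀ w → IsStraightRoute quiver~ w →
                            w ∈ straightRoutes ⊎ inverse quiver~ w ∈ straightRoutes
  straightRoutes-complete w (route , inj₂ invs) = inj₁ (inverse-route∈straightRoutes route invs)
  straightRoutes-complete w (route , inj₁ dirs) =
    inj₂ (inverse-route∈straightRoutes (inverse-isRoute route) (inverse-dir dirs))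

  backString-distinct : ∀ {j j′} → j ≢ j′ →
    backString (inj₂ j) ≢ backString (inj₂ j′) × backString (inj₂ j) ≢ inverse quiver~ (backString (inj₂ j′))
  backString-distinct {j} {j′} j≢j′ with stringOf-∷ (reaches (inj₂ j)) | stringOf-∷ (reaches (inj₂ j′))
  ... | w , eq | w′ , eq′ = different-heads , not-inverse
    where
    different-heads : backString (inj₂ j) ≢ backString (inj₂ j′)
    different-heads e with trans (sym eq) (trans e eq′)
    ... | refl = j≢j′ refl
    not-inverse : backString (inj₂ j) ≢ inverse quiver~ (backString (inj₂ j′))
    not-inverse e with All.lookup (stringOf-inv (reaches (inj₂ j))) (subst (dir (inj₂ j′) ∈_) (sym unfolded) last∈)
      where
      unfolded : backString (inj₂ j) ≡ inverse quiver~ w′ ∷ʳ dir (inj₂ j′)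
      unfolded = trans e (trans (cong (inverse quiver~) eq′) (inverse-∷ (inv (inj₂ j′)) w′))
      last∈ : dir (inj₂ j′) ∈ inverse quiver~ w′ ∷ʳ dir (inj₂ j′)
      last∈ = ∈P.∈-++⁺ʳ (inverse quiver~ w′) (here refl)
    ... | ()

  straightRoutes-counts : CountsStraightRoutes quiver~ straightRoutes
  straightRoutes-counts =
      AllP.map⁺ (All.tabulate (backString-straight ∘ fringeArrows-sound true))
    , straightRoutes-complete
    , AllPairsP.map⁺ (AllPairs.map backString-distinct (fringeArrows-unique true))

  length-straightRoutes : length straightRoutes ≡ s
  length-straightRoutes = trans (ListP.length-map (backString ∘ inj₂) outward) outward≡s

module Coordinates {Λ : GentleAlgebra} (Λ~ : Fringing Λ) where
  open import Data.Bool using (false)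
  open import Data.Fin as Fin using (Fin; _↑ˡ_; _↑ʳ_)
  import Data.Fin.Properties as FinP
  open import Data.Nat as ℕ using ()
  open import Data.Product using (_×_; _,_; proj₁; proj₂)
  open import Data.Rational using (ℚ; 0ℚ; 1ℚ; ½; _*_)
  import Data.Rational.Properties as ℚP
  open import Data.Sum using (inj₁; inj₂; [_,_]′)
  open import Data.Vec.Functional using (_++_)
  open import Function using (_∘_)
  open import Relation.Binary.PropositionalEquality
  open import Tactic.RingSolver using (solve-∀)
  open RationalArithmetic
  open LinearAlgebra

  open GentleAlgebra Λ using (n)
  open Fringing Λ~
  open Flows Λ~
  open FringeArrows Λ~ using (s; source; source-surjective)

  -- By conserves-zero these n + s numbers determine a conserving function.
  coordinates : (E Λ~ → ℚ) → Fin (n ℕ.+ s) → ℚ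
  coordinates h = (λ v → Δ v h) ++ (λ k → h (inj₂ (source k)))

  coordinates-combination : ∀ {k} (c : Fin k → ℚ) (p : Fin k → E Λ~ → ℚ) d →
    coordinates (combination c p) d ≡ ∑[ i < k ] (c i * coordinates (p i) d)
  coordinates-combination c p d with Fin.splitAt n d
  ... | inj₁ v = Δ-combination c p v
  ... | inj₂ _ = refl

  coordinates-zero : ∀ h → (∀ d → coordinates h d ≡ 0ℚ) →
                     (∀ v → Δ v h ≡ 0ℚ) × (∀ j → out j ≡ false → h (inj₂ j) ≡ 0ℚ)
  coordinates-zero h coordinates≡0 = increments , sources
    where
    increments : ∀ v → Δ v h ≡ 0ℚ
    increments v = trans (cong [ (λ v → Δ v h) , _ ]′ (sym (FinP.splitAt-↑ˡ n v s)))
                         (coordinates≡0 (v ↑ˡ s))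
    sources : ∀ j → out j ≡ false → h (inj₂ j) ≡ 0ℚ
    sources j o with source-surjective o
    ... | k , refl = trans (cong [ _ , (λ k → h (inj₂ (source k))) ]′ (sym (FinP.splitAt-↑ʳ n s k)))
                           (coordinates≡0 (n ↑ʳ k))

  F₁-combination-zero⇒∑≡0 : ∀ {k} (c : Fin k → ℚ) (p : Fin k → E Λ~ → ℚ) → (∀ i → F₁ Λ~ (p i)) →
    (∀ e → combination c p e ≡ 0ℚ) → sum c ≡ 0ℚ
  F₁-combination-zero⇒∑≡0 {k} c p inF₁ combination≡0 = begin
    sum c
      ≡⟨ sum-cong-≗ (λ i → trans (sym (ℚP.*-identityʳ (c i))) (cong (c i *_) (sym (normalised i)))) ⟩
    ∑[ i < k ] (c i * (½ * ∑[ j < b ] p i (inj₂ j)))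
      ≡⟨ sum-cong-≗ (λ i → trans (rearrange (c i) _)
                                 (cong (½ *_) (*-distribˡ-sum (c i) (λ j → p i (inj₂ j))))) ⟩
    ∑[ i < k ] (½ * ∑[ j < b ] (c i * p i (inj₂ j)))
      ≡⟨ sym (*-distribˡ-sum ½ (λ i → ∑[ j < b ] (c i * p i (inj₂ j)))) ⟩
    ½ * ∑[ i < k ] ∑[ j < b ] (c i * p i (inj₂ j))
      ≡⟨ cong (½ *_) (∑-comm (λ i j → c i * p i (inj₂ j))) ⟩
    ½ * ∑[ j < b ] combination c p (inj₂ j)
      ≡⟨ cong (½ *_) (trans (sum-cong-≗ (combination≡0 ∘ inj₂)) (sum-replicate-zero b)) ⟩
    0ℚ ∎
    where
    open ≡-Reasoning
    normalised : ∀ i → ½ * ∑[ j < b ] p i (inj₂ j) ≡ 1ℚ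
    normalised i = trans (cong (½ *_) (sym (sumFin≡sum b _))) (proj₂ (inF₁ i))
    rearrange : ∀ x y → x * (½ * y) ≡ ½ * (x * y)
    rearrange = solve-∀ ℚ-ring

  F₁-independent⇒≤ : ∀ {k} (p : Fin k → E Λ~ → ℚ) → (∀ i → F₁ Λ~ (p i)) →
                     AffinelyIndependent k p → k ℕ.≤ n ℕ.+ s
  F₁-independent⇒≤ {k} p inF₁ affine = linearlyIndependent⇒≤ (coordinates ∘ p) linear
    where
    linear : LinearlyIndependent k (n ℕ.+ s) (coordinates ∘ p)
    linear c coordinates≡0 = affine c (trans (sumFin≡sum k c) (F₁-combination-zero⇒∑≡0 c p inF₁ h≡0))
                                      (λ e → trans (sumFin≡sum k _) (h≡0 e))
      where
      h : E Λ~ → ℚ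
      h = combination c p
      h-coordinates≡0 : (∀ v → Δ v h ≡ 0ℚ) × (∀ j → out j ≡ false → h (inj₂ j) ≡ 0ℚ)
      h-coordinates≡0 = coordinates-zero h (λ d → trans (coordinates-combination c p d) (coordinates≡0 d))
      h≡0 : ∀ e → h e ≡ 0ℚ
      h≡0 = conserves-zero (combination-conserves c p (proj₂ ∘ proj₁ ∘ inF₁))
                           (proj₁ h-coordinates≡0) (proj₂ h-coordinates≡0)

module Basis {Λ : GentleAlgebra} (Λ~ : Fringing Λ) where
  open import Data.Bool using (false)
  open import Data.Fin as Fin using (Fin; _↑ˡ_; _↑ʳ_)
  import Data.Fin.Properties as FinP
  open import Data.Nat as ℕ using ()
  open import Data.Product using (∃; _×_; _,_)
  open import Data.Rational as ℚ using (ℚ; 0ℚ; 1ℚ; ½; _+_; _-_; _*_; _≤_)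
  import Data.Rational.Properties as ℚP
  open import Data.Sum using (_⊎_; inj₁; inj₂)
  open import Function using (_∘_)
  open import Relation.Binary.PropositionalEquality
  open import Tactic.RingSolver using (solve-∀)
  open RationalArithmetic

  open GentleAlgebra Λ using (n)
  open Fringing Λ~
  open FringedQuiver Λ~
  open Flows Λ~
  open FringeArrows Λ~ using (s; source; source-inward; source-injective)

  basisIncrements : Fin n ⊎ Fin s → Fin n → ℚ
  basisIncrements (inj₁ w) v = 𝟙 (w Fin.≟ v)
  basisIncrements (inj₂ _) _ = 0ℚ

  -- The vertex flows are 1 on every source, rather than 0, so that their fringe mass is positive.
  basisSources : Fin n ⊎ Fin s → Fin b → ℚ
  basisSources (inj₁ _) _ = 1ℚ
  basisSources (inj₂ k) j = 𝟙 (source k Fin.≟ j)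

  basisFlow : Fin (n ℕ.+ s) → E Λ~ → ℚ
  basisFlow i = flowWith (basisIncrements (Fin.splitAt n i)) (basisSources (Fin.splitAt n i))

  basisFlow-nonneg : ∀ i e → 0ℚ ≤ basisFlow i e
  basisFlow-nonneg i = flowWith-nonneg _ _ (increments≥0 (Fin.splitAt n i)) (sources≥0 (Fin.splitAt n i))
    where
    increments≥0 : ∀ x v → 0ℚ ≤ basisIncrements x v
    increments≥0 (inj₁ w) v = 𝟙-nonneg (w Fin.≟ v)
    increments≥0 (inj₂ _) _ = ℚP.≤-refl
    sources≥0 : ∀ x j → 0ℚ ≤ basisSources x j
    sources≥0 (inj₁ _) _ = ℚP.<⇒≤ (ℚP.positive⁻¹ 1ℚ)
    sources≥0 (inj₂ k) j = 𝟙-nonneg (source k Fin.≟ j)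

  fringeMass : (E Λ~ → ℚ) → ℚ
  fringeMass h = ½ * ∑[ j < b ] h (inj₂ j)

  basisSources-unit : ∀ x → ∃ λ j → out j ≡ false × basisSources x j ≡ 1ℚ
  basisSources-unit (inj₁ w) with reaches-inward (reaches (outArrow w))
  ... | j , o = j , o , refl
  basisSources-unit (inj₂ k) = source k , source-inward k , 𝟙-refl (source k)

  fringeMass-basisFlow : ∀ i → 0ℚ ℚ.< fringeMass (basisFlow i)
  fringeMass-basisFlow i with basisSources-unit (Fin.splitAt n i)
  ... | j , o , unit = ℚP.*-monoʳ-<-pos ½ (∑-pos _ (basisFlow-nonneg i ∘ inj₂) j
                         (subst (0ℚ ℚ.<_) (sym (trans (flowWith-source _ _ o) unit)) (ℚP.positive⁻¹ 1ℚ)))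

  scale : Fin (n ℕ.+ s) → ℚ
  scale i = (ℚ.1/ fringeMass (basisFlow i)) {{ℚ.>-nonZero (fringeMass-basisFlow i)}}

  scale-pos : ∀ i → 0ℚ ℚ.< scale i
  scale-pos i = ℚP.positive⁻¹ (scale i)
    {{ℚP.1/pos⇒pos (fringeMass (basisFlow i)) {{ℚ.positive (fringeMass-basisFlow i)}}}}

  basis : Fin (n ℕ.+ s) → E Λ~ → ℚ
  basis i e = basisFlow i e * scale i

  basis-F₁ : ∀ i → F₁ Λ~ (basis i)
  basis-F₁ i = (nonneg , scaled-conserves (basisFlow i) (scale i) conserves) , normalised
    where
    conserves : Conserves (basisFlow i)
    conserves = flowWith-conserves _ _
    nonneg : ∀ e → 0ℚ ≤ basis i e
    nonneg e = *-nonneg (basisFlow-nonneg i e) (ℚP.<⇒≤ (scale-pos i))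
    normalised : ½ * sumFin b (λ j → basis i (inj₂ j)) ≡ 1ℚ
    normalised = begin
      ½ * sumFin b (λ j → basis i (inj₂ j))
        ≡⟨ cong (½ *_) (sumFin≡sum b (λ j → basis i (inj₂ j))) ⟩
      ½ * ∑[ j < b ] (basisFlow i (inj₂ j) * scale i)
        ≡⟨ cong (½ *_) (sym (*-distribʳ-sum (scale i) (λ j → basisFlow i (inj₂ j)))) ⟩
      ½ * (∑[ j < b ] basisFlow i (inj₂ j) * scale i)
        ≡⟨ sym (ℚP.*-assoc ½ (∑[ j < b ] basisFlow i (inj₂ j)) (scale i)) ⟩
      fringeMass (basisFlow i) * scale i
        ≡⟨ ℚP.*-inverseʳ (fringeMass (basisFlow i)) {{ℚ.>-nonZero (fringeMass-basisFlow i)}} ⟩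
      1ℚ ∎
      where open ≡-Reasoning

  module _ (c : Fin (n ℕ.+ s) → ℚ) (combination≡0 : ∀ e → combination c basisFlow e ≡ 0ℚ) where
    open ≡-Reasoning

    vertex-coefficient : ∀ u → c (u ↑ˡ s) ≡ 0ℚ
    vertex-coefficient u = begin
      c (u ↑ˡ s)
        ≡⟨ sym (ℚP.+-identityʳ _) ⟩
      c (u ↑ˡ s) + 0ℚ
        ≡⟨ cong₂ _+_ (sym (∑-select (λ w → c (w ↑ˡ s)) u))
                     (sym (trans (sum-cong-≗ (λ k → ℚP.*-zeroʳ (c (n ↑ʳ k)))) (sum-replicate-zero s))) ⟩
      ∑[ w < n ] (c (w ↑ˡ s) * 𝟙 (w Fin.≟ u)) + ∑[ k < s ] (c (n ↑ʳ k) * 0ℚ)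
        ≡⟨ sym (∑-splitAt n s c (λ x → basisIncrements x u)) ⟩
      ∑[ i < n ℕ.+ s ] (c i * basisIncrements (Fin.splitAt n i) u)
        ≡⟨ sum-cong-≗ (λ i → cong (c i *_) (sym (Δ-flowWith _ _ u))) ⟩
      ∑[ i < n ℕ.+ s ] (c i * Δ u (basisFlow i))
        ≡⟨ sym (Δ-combination c basisFlow u) ⟩
      Δ u (combination c basisFlow)
        ≡⟨ cong₂ _-_ (combination≡0 (outArrow u)) (combination≡0 (pred (outArrow u))) ⟩
      0ℚ ∎

    source-coefficient : ∀ k′ → c (n ↑ʳ k′) ≡ 0ℚ
    source-coefficient k′ = begin
      c (n ↑ʳ k′)
        ≡⟨ sym (ℚP.+-identityˡ _) ⟩
      0ℚ + c (n ↑ʳ k′)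
        ≡⟨ cong₂ _+_ (sym (trans (sum-cong-≗ (λ w → trans (ℚP.*-identityʳ _) (vertex-coefficient w)))
                                 (sum-replicate-zero n)))
                     (sym (∑-select (λ k → c (n ↑ʳ k)) k′)) ⟩
      ∑[ w < n ] (c (w ↑ˡ s) * 1ℚ) + ∑[ k < s ] (c (n ↑ʳ k) * 𝟙 (k Fin.≟ k′))
        ≡⟨ cong (∑[ w < n ] (c (w ↑ˡ s) * 1ℚ) +_)
                (sum-cong-≗ (λ k → cong (c (n ↑ʳ k) *_) (sym (𝟙-injective source-injective k k′)))) ⟩
      ∑[ w < n ] (c (w ↑ˡ s) * 1ℚ) + ∑[ k < s ] (c (n ↑ʳ k) * 𝟙 (source k Fin.≟ source k′))
        ≡⟨ sym (∑-splitAt n s c (λ x → basisSources x (source k′))) ⟩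
      ∑[ i < n ℕ.+ s ] (c i * basisSources (Fin.splitAt n i) (source k′))
        ≡⟨ sum-cong-≗ (λ i → cong (c i *_) (sym (flowWith-source _ _ (source-inward k′)))) ⟩
      combination c basisFlow (inj₂ (source k′))
        ≡⟨ combination≡0 (inj₂ (source k′)) ⟩
      0ℚ ∎

    basisFlow-independent : ∀ i → c i ≡ 0ℚ
    basisFlow-independent i = trans (cong c (sym (FinP.join-splitAt n s i))) (by-part (Fin.splitAt n i))
      where
      by-part : ∀ x → c (Fin.join n s x) ≡ 0ℚ
      by-part (inj₁ w) = vertex-coefficient w
      by-part (inj₂ k) = source-coefficient k

  -- The basis is even linearly independent, so the hypothesis on the coefficient sum is not needed.
  basis-independent : AffinelyIndependent (n ℕ.+ s) basis
  basis-independent c _ combination≡0 i =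
    *-cancelʳ-≢0 (λ eq → ℚP.<-irrefl (sym eq) (scale-pos i)) (basisFlow-independent (λ i → c i * scale i) rescaled i)
    where
    reassoc : ∀ a t f → (a * t) * f ≡ a * (f * t)
    reassoc = solve-∀ ℚ-ring
    rescaled : ∀ e → combination (λ i → c i * scale i) basisFlow e ≡ 0ℚ
    rescaled e = trans (sum-cong-≗ (λ i → reassoc (c i) (scale i) (basisFlow i e)))
                       (trans (sym (sumFin≡sum (n ℕ.+ s) (λ i → c i * basis i e))) (combination≡0 e))

module IntegerArithmetic where
  open import Data.Nat using (_+_)
  open import Data.Integer as ℤ using (ℤ; +_)
  import Data.Integer.Properties as ℤP
  import Data.Integer.Tactic.RingSolver as ℤ-Solver
  open import Relation.Binary.PropositionalEquality

  m+[m+n]-m≡m+n : ∀ m n → + (m + (m + n)) ℤ.- + m ≡ + m ℤ.+ + n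
  m+[m+n]-m≡m+n m n = trans (cong (ℤ._- + m) split) (cancel (+ m) (+ n))
    where
    split : + (m + (m + n)) ≡ + m ℤ.+ (+ m ℤ.+ + n)
    split = trans (ℤP.pos-+ m (m + n)) (cong (λ i → + m ℤ.+ i) (ℤP.pos-+ m n))
    cancel : ∀ x y → (x ℤ.+ (x ℤ.+ y)) ℤ.- x ≡ x ℤ.+ y
    cancel = ℤ-Solver.solve-∀

  i-1+1≡i : ∀ i → (i ℤ.- ℤ.1ℤ) ℤ.+ ℤ.1ℤ ≡ i
  i-1+1≡i = ℤ-Solver.solve-∀

open import Data.Nat using (ℕ; _+_)
open import Data.Integer as ℤ using (ℤ; +_)
open import Data.List using (List; length)
open import Data.Product using (Σ; _×_; _,_)
open import Relation.Binary.PropositionalEquality using (_≡_; cong; trans; sym)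
import Data.Integer.Properties as ℤP
open IntegerArithmetic

lemma4p5 : (Λ : GentleAlgebra) (Λ~ : Fringing Λ) →
    HasDimension (F₁ Λ~)
      ((+ (GentleAlgebra.m Λ + Fringing.b Λ~) ℤ.- + GentleAlgebra.n Λ) ℤ.- ℤ.1ℤ)
    × Σ (List (List (Letter (E Λ~)))) (λ L →
        CountsStraightRoutes (Fringing.quiver~ Λ~) L
        × ((+ (GentleAlgebra.m Λ + Fringing.b Λ~) ℤ.- + GentleAlgebra.n Λ) ℤ.- ℤ.1ℤ
           ≡ (+ GentleAlgebra.n Λ ℤ.+ + length L) ℤ.- ℤ.1ℤ))
lemma4p5 Λ Λ~ =
    ( n + s , d+1≡n+s
    , (basis , basis-F₁ , basis-independent)
    , λ _ → F₁-independent⇒≤ )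
  , straightRoutes , straightRoutes-counts
  , cong (ℤ._- ℤ.1ℤ) (trans excess (cong (λ k → + n ℤ.+ + k) (sym length-straightRoutes)))
  where
  open GentleAlgebra Λ using (n; m)
  open Fringing Λ~ using (b)
  open FringeArrows Λ~ using (s; arrows-count)
  open Coordinates Λ~ using (F₁-independent⇒≤)
  open Basis Λ~ using (basis; basis-F₁; basis-independent)
  open StraightRoutes Λ~ using (straightRoutes; straightRoutes-counts; length-straightRoutes)

  excess : + (m + b) ℤ.- + n ≡ + n ℤ.+ + s
  excess = trans (cong (λ k → + k ℤ.- + n) arrows-count) (m+[m+n]-m≡m+n n s)

  d+1≡n+s : ((+ (m + b) ℤ.- + n) ℤ.- ℤ.1ℤ) ℤ.+ ℤ.1ℤ ≡ + (n + s)
  d+1≡n+s = trans (i-1+1≡i _) (trans excess (sym (ℤP.pos-+ n s)))
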